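{- For any index $(k_{1}, \ldots , k_{r}) \in {\mathbb N}^{r}$ with $r \ge 2$, we have \begin{align*} &\phi((-1)^{k_{r}}x_0^{k_{r}}(y_{k_{1}} \mathbin{\sqcup\!\sqcup} \cdots \mathbin{\sqcup\!\sqcup} y_{k_{r-1}}))\\ &=\sum_{a=1}^{r}(-1)^{k_{a}}x_0^{k_{a}}(y_{k_{1}} \mathbin{\sqcup\!\sqcup} \cdots \mathbin{\sqcup\!\sqcup} y_{k_{a-1}}\mathbin{\sqcup\!\sqcup} y_{k_{a+1}} \mathbin{\sqcup\!\sqcup} \cdots \mathbin{\sqcup\!\sqcup} y_{k_{r}}). \end{align*}
   Context: Let $\mathfrak{h}=\mathbb{Q}\langle x_0,x_1\rangle$, $\mathfrak{h}^1=\mathbb{Q}+\mathfrak{h}x_1$, $y_k=x_0^{k-1}x_1$. The shuffle product $\mathbin{\sqcup\!\sqcup}$ on $\mathfrak{h}$ is defined by $uw\mathbin{\sqcup\!\sqcup} vw'=u(w\mathbin{\sqcup\!\sqcup} vw')+v(uw\mathbin{\sqcup\!\sqcup} w')$ for $u,v\in\{x_0,x_1\}$, $w,w'\in\mathfrak{h}$, with $1\mathbin{\sqcup\!\sqcup} w=w\mathbin{\sqcup\!\sqcup} 1=w$. Let $\phi:\mathfrak{h}^1\to\mathfrak{h}^1$ be the $\mathbb{Q}$-linear map with $\phi(1)=1$ and $\phi(y_{k_1}\cdots y_{k_r})=\sum_{a=0}^r(-1)^{k_1+\cdots+k_a}(y_{k_a}y_{k_{a-1}}\cdots y_{k_1})\mathbin{\sqcup\!\sqcup}(y_{k_{a+1}}y_{k_{a+2}}\cdots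 y_{k_r})$. -}

module Defs where

open import Data.Bool using (Bool; true; false)
open import Data.Nat using (ℕ; zero; suc; _+_; _∸_)
open import Data.Fin using (Fin)
open import Data.List using (List; []; _∷_; _++_; map; replicate; foldr; take; drop; reverse; upTo; allFin; length; lookup; removeAt; concatMap)
open import Data.List.Properties using (≡-dec)
open import Data.Bool.Properties using () renaming (_≟_ to _≟B_)
open import Data.Product using (_×_; _,_)
open import Data.Maybe using (Maybe; just; nothing)
open import Data.Rational using (ℚ; 0ℚ; 1ℚ; -_) renaming (_+_ to _+ℚ_; _*_ to _*ℚ_)
open import Relation.Nullary using (yes; no)
open import Relation.Binary.PropositionalEquality using (_≡_)

-- Letters: false = x₀, true = x₁.  Words of 𝔥 are List Bool.
Word : Set
Word = List Bool

-- An element of 𝔥 = ℚ⟨x₀,x₁⟩ represented as a finite formal ℚ-linear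
-- combination of words (not normalised); equality is coefficientwise (_≈_).
Poly : Set
Poly = List (ℚ × Word)

coeff : Word → Poly → ℚ
coeff w [] = 0ℚ
coeff w ((c , v) ∷ p) with ≡-dec _≟B_ w v
... | yes _ = c +ℚ coeff w p
... | no _  = coeff w p

_≈_ : Poly → Poly → Set
p ≈ q = ∀ w → coeff w p ≡ coeff w q

zeroP : Poly
zeroP = []

oneP : Poly
oneP = (1ℚ , []) ∷ []

_⊕_ : Poly → Poly → Poly
p ⊕ q = p ++ q

scale : ℚ → Poly → Poly
scale c = map (λ { (d , w) → (c *ℚ d , w) })

sumP : List Poly → Poly
sumP = foldr _⊕_ zeroP

_·_ : Word → Poly → Poly
u · p = map (λ { (d , w) → (d , u ++ w) }) p

shw : Word → Word → Poly
shw [] v = (1ℚ , v) ∷ []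
shw (a ∷ u) [] = (1ℚ , a ∷ u) ∷ []
shw (a ∷ u) (b ∷ v) = ((a ∷ []) · shw u (b ∷ v)) ⊕ ((b ∷ []) · shw (a ∷ u) v)

_⧢_ : Poly → Poly → Poly
p ⧢ q = concatMap (λ { (c , u) → concatMap (λ { (d , v) → scale (c *ℚ d) (shw u v) }) q }) p

x0^ : ℕ → Word
x0^ k = replicate k false

-- y_k = x₀^{k-1} x₁ (used only for k ≥ 1)
y : ℕ → Word
y k = x0^ (k ∸ 1) ++ (true ∷ [])

yword : List ℕ → Word
yword ks = foldr (λ k w → y k ++ w) [] ks

shY : List ℕ → Poly
shY ks = foldr (λ k p → ((1ℚ , y k) ∷ []) ⧢ p) oneP ks

neg1^ : ℕ → ℚ
neg1^ zero = 1ℚ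
neg1^ (suc n) = - neg1^ n

sumℕ : List ℕ → ℕ
sumℕ = foldr _+_ 0

-- decomposition of a word of 𝔥¹ into y-indices; nothing if the word ends in x₀
parseAux : ℕ → Word → Maybe (List ℕ)
parseAux n [] with n
... | zero = just []
... | suc _ = nothing
parseAux n (false ∷ w) = parseAux (suc n) w
parseAux n (true ∷ w) with parseAux 0 w
... | just ks = just (suc n ∷ ks)
... | nothing = nothing

parse : Word → Maybe (List ℕ)
parse = parseAux 0

φY : List ℕ → Poly
φY ks = sumP (map (λ a → scale (neg1^ (sumℕ (take a ks)))
                              (((1ℚ , yword (reverse (take a ks))) ∷ [])
                                ⧢ ((1ℚ , yword (drop a ks)) ∷ [])))
                  (upTo (suc (length ks))))

-- φ on words (words outside 𝔥¹ are sent to 0; never used on such words)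
φw : Word → Poly
φw w with parse w
... | just ks = φY ks
... | nothing = zeroP

φ : Poly → Poly
φ p = concatMap (λ { (c , w) → scale c (φw w) }) p

module Submission where

-- The heart of the proof is the operator
--   T Q (c w) = [c = x₁] (Q ⧢ w) − T (c Q) w,      T Q 1 = 0,
-- i.e. T Q w = Σ_i (-1)^i [w_{i+1} = x₁] (w_i ⋯ w₁ Q) ⧢ (w_{i+2} ⋯).
-- (1) For a word w ending in x₁ one has φ(w) = w − T x₁ w  (φ-word-T).
-- (2) T satisfies a Leibniz rule for the shuffle product  (T-leibniz).
-- (3) Hence T (x₀ Q) (y_{k₁} ⧢ ⋯ ⧢ y_{k_m}) = −Σ_a (-1)^{k_a} x₀^{k_a}
--     (Q ⧢ ⧢_{b≠a} y_{k_b})  (T-x₀-shuffleY), and T moves a prefix x₀^n of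
--     its word argument into Q at the cost of a sign (-1)^n  (T-x₀-prefix).
-- The theorem follows by applying (1) to every word of x₀^{k_r}(⧢ y_{k_i}),
-- which all end in x₁, then (3) with Q = y_{k_r}, and reindexing the sum.

open import Defs
open import Data.Nat using (ℕ; _≤_)
open import Data.List using (List; _∷ʳ_; length; map; allFin; lookup; removeAt)
open import Data.List.Relation.Unary.All using (All)
open import Data.Product using (_,_)

open import Data.Bool using (Bool; true; false)
open import Data.Nat using (zero; suc; _∸_; s≤s; z≤n)
import Data.Nat as ℕ
import Data.Nat.Properties as ℕP
open import Data.List using ([]; _∷_; _++_; take; drop; reverse; upTo; tabulate)
import Data.List.Properties as LP
import Data.List.Relation.Unary.All as All
import Data.List.Relation.Unary.All.Properties as AllP
open import Data.Product using (_×_; proj₁; proj₂; Σ)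
open import Data.Sum using (_⊎_; inj₁; inj₂)
open import Data.Rational using (ℚ; 0ℚ; 1ℚ; -_) renaming (_+_ to _+ℚ_; _*_ to _*ℚ_)
import Data.Rational.Properties as ℚP
open import Data.Rational.Solver using (module +-*-Solver)
open import Relation.Binary.PropositionalEquality
open import Relation.Binary.Bundles using (Setoid)
import Relation.Binary.Reasoning.Setoid as SetoidReasoning
open import Relation.Nullary using (yes; no; ¬_)
open import Data.List.Properties using (≡-dec)
open import Data.Bool.Properties using () renaming (_≟_ to _≟B_)
open import Data.Empty using (⊥-elim)
open import Data.Maybe using (just)

open +-*-Solver using (solve; _:=_; _:+_; _:*_; :-_; con)

coeff-++ : ∀ w p q → coeff w (p ++ q) ≡ coeff w p +ℚ coeff w q
coeff-++ w [] q = sym (ℚP.+-identityˡ _)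
coeff-++ w ((c , v) ∷ p) q with ≡-dec _≟B_ w v
... | yes _ = trans (cong (c +ℚ_) (coeff-++ w p q)) (sym (ℚP.+-assoc c _ _))
... | no _ = coeff-++ w p q

coeff-scale : ∀ w c p → coeff w (scale c p) ≡ c *ℚ coeff w p
coeff-scale w c [] = sym (ℚP.*-zeroʳ c)
coeff-scale w c ((d , v) ∷ p) with ≡-dec _≟B_ w v
... | yes _ = trans (cong ((c *ℚ d) +ℚ_) (coeff-scale w c p)) (sym (ℚP.*-distribˡ-+ c d _))
... | no _ = coeff-scale w c p

dot : (Word → ℚ) → Poly → ℚ
dot g [] = 0ℚ
dot g ((c , u) ∷ p) = c *ℚ g u +ℚ dot g p

-- Deleting every occurrence of the word v; used to show that dot g only
-- depends on the coefficients of its argument (dot-resp).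
dropWord : Word → Poly → Poly
dropWord v [] = []
dropWord v ((c , u) ∷ p) with ≡-dec _≟B_ v u
... | yes _ = dropWord v p
... | no _ = (c , u) ∷ dropWord v p

coeff-dropWord-same : ∀ v p → coeff v (dropWord v p) ≡ 0ℚ
coeff-dropWord-same v [] = refl
coeff-dropWord-same v ((c , u) ∷ p) with ≡-dec _≟B_ v u
... | yes _ = coeff-dropWord-same v p
... | no v≢u with ≡-dec _≟B_ v u
...   | yes v≡u = ⊥-elim (v≢u v≡u)
...   | no _ = coeff-dropWord-same v p

coeff-dropWord-other : ∀ w v p → ¬ (w ≡ v) → coeff w (dropWord v p) ≡ coeff w p
coeff-dropWord-other w v [] w≢v = refl
coeff-dropWord-other w v ((c , u) ∷ p) w≢v with ≡-dec _≟B_ v u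
... | yes refl with ≡-dec _≟B_ w u
...   | yes w≡v = ⊥-elim (w≢v w≡v)
...   | no _ = coeff-dropWord-other w v p w≢v
coeff-dropWord-other w v ((c , u) ∷ p) w≢v | no _ with ≡-dec _≟B_ w u
...   | yes _ = cong (c +ℚ_) (coeff-dropWord-other w v p w≢v)
...   | no _ = coeff-dropWord-other w v p w≢v

dropWord-≈ : ∀ v p q → p ≈ q → dropWord v p ≈ dropWord v q
dropWord-≈ v p q p≈q w with ≡-dec _≟B_ w v
... | yes refl = trans (coeff-dropWord-same w p) (sym (coeff-dropWord-same w q))
... | no w≢v = trans (coeff-dropWord-other w v p w≢v)
                 (trans (p≈q w) (sym (coeff-dropWord-other w v q w≢v)))

dot-split : ∀ g v p → dot g p ≡ coeff v p *ℚ g v +ℚ dot g (dropWord v p)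
dot-split g v [] = sym (trans (ℚP.+-identityʳ _) (ℚP.*-zeroˡ (g v)))
dot-split g v ((c , u) ∷ p) with ≡-dec _≟B_ v u
... | yes refl = begin
    c *ℚ g v +ℚ dot g p ≡⟨ cong (c *ℚ g v +ℚ_) (dot-split g v p) ⟩
    c *ℚ g v +ℚ (coeff v p *ℚ g v +ℚ dot g (dropWord v p))
      ≡⟨ solve 4 (λ a b x y → a :* x :+ (b :* x :+ y) := (a :+ b) :* x :+ y) refl
           c (coeff v p) (g v) (dot g (dropWord v p)) ⟩
    (c +ℚ coeff v p) *ℚ g v +ℚ dot g (dropWord v p) ∎
  where open ≡-Reasoning
... | no _ = begin
    c *ℚ g u +ℚ dot g p ≡⟨ cong (c *ℚ g u +ℚ_) (dot-split g v p) ⟩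
    c *ℚ g u +ℚ (coeff v p *ℚ g v +ℚ dot g (dropWord v p))
      ≡⟨ solve 3 (λ a b y → a :+ (b :+ y) := b :+ (a :+ y)) refl
           (c *ℚ g u) (coeff v p *ℚ g v) (dot g (dropWord v p)) ⟩
    coeff v p *ℚ g v +ℚ (c *ℚ g u +ℚ dot g (dropWord v p)) ∎
  where open ≡-Reasoning

length-dropWord : ∀ v p → length (dropWord v p) ≤ length p
length-dropWord v [] = z≤n
length-dropWord v ((c , u) ∷ p) with ≡-dec _≟B_ v u
... | yes _ = ℕP.m≤n⇒m≤1+n (length-dropWord v p)
... | no _ = s≤s (length-dropWord v p)

length-dropWord-head : ∀ c v p → length (dropWord v ((c , v) ∷ p)) ≤ length p
length-dropWord-head c v p with ≡-dec _≟B_ v v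
... | yes _ = length-dropWord v p
... | no v≢v = ⊥-elim (v≢v refl)

-- dot g respects ≈, by induction on the total length n of both sides:
-- split off a word occurring in one of them and recurse on the rest.
dot-resp-bounded : ∀ g n p q → length p ℕ.+ length q ≤ n → p ≈ q → dot g p ≡ dot g q
dot-resp-bounded g n [] [] _ _ = refl
dot-resp-bounded g zero ((c , v) ∷ p) q () p≈q
dot-resp-bounded g (suc n) ((c , v) ∷ p) q bound p≈q = begin
    dot g ((c , v) ∷ p) ≡⟨ dot-split g v ((c , v) ∷ p) ⟩
    coeff v ((c , v) ∷ p) *ℚ g v +ℚ dot g (dropWord v ((c , v) ∷ p))
      ≡⟨ cong₂ (λ a b → a *ℚ g v +ℚ b) (p≈q v)
           (dot-resp-bounded g n (dropWord v ((c , v) ∷ p)) (dropWord v q)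
             (ℕP.≤-trans (ℕP.+-mono-≤ (length-dropWord-head c v p) (length-dropWord v q)) (ℕ.s≤s⁻¹ bound))
             (dropWord-≈ v ((c , v) ∷ p) q p≈q)) ⟩
    coeff v q *ℚ g v +ℚ dot g (dropWord v q) ≡⟨ sym (dot-split g v q) ⟩
    dot g q ∎
  where open ≡-Reasoning
dot-resp-bounded g zero [] ((c , v) ∷ q) () p≈q
dot-resp-bounded g (suc n) [] ((c , v) ∷ q) bound p≈q = begin
    dot g [] ≡⟨ dot-split g v [] ⟩
    coeff v [] *ℚ g v +ℚ dot g (dropWord v [])
      ≡⟨ cong₂ (λ a b → a *ℚ g v +ℚ b) (p≈q v)
           (dot-resp-bounded g n [] (dropWord v ((c , v) ∷ q)) (ℕP.≤-trans (length-dropWord-head c v q) (ℕ.s≤s⁻¹ bound))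
             (dropWord-≈ v [] ((c , v) ∷ q) p≈q)) ⟩
    coeff v ((c , v) ∷ q) *ℚ g v +ℚ dot g (dropWord v ((c , v) ∷ q)) ≡⟨ sym (dot-split g v ((c , v) ∷ q)) ⟩
    dot g ((c , v) ∷ q) ∎
  where open ≡-Reasoning

dot-resp : ∀ g p q → p ≈ q → dot g p ≡ dot g q
dot-resp g p q = dot-resp-bounded g _ p q ℕP.≤-refl

dot-cong : ∀ {g h} p → (∀ u → g u ≡ h u) → dot g p ≡ dot h p
dot-cong [] g≗h = refl
dot-cong ((c , u) ∷ p) g≗h = cong₂ (λ a b → c *ℚ a +ℚ b) (g≗h u) (dot-cong p g≗h)

dot-cong-All : ∀ {g h} p → All (λ t → g (proj₂ t) ≡ h (proj₂ t)) p → dot g p ≡ dot h p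
dot-cong-All [] _ = refl
dot-cong-All ((c , u) ∷ p) (e All.∷ es) = cong₂ (λ a b → c *ℚ a +ℚ b) e (dot-cong-All p es)

dot-scale : ∀ g c p → dot g (scale c p) ≡ c *ℚ dot g p
dot-scale g c [] = sym (ℚP.*-zeroʳ c)
dot-scale g c ((d , u) ∷ p) = trans (cong ((c *ℚ d) *ℚ g u +ℚ_) (dot-scale g c p))
  (solve 4 (λ c d x y → c :* d :* x :+ c :* y := c :* (d :* x :+ y)) refl c d (g u) (dot g p))

dot-add : ∀ g h p → dot (λ u → g u +ℚ h u) p ≡ dot g p +ℚ dot h p
dot-add g h [] = refl
dot-add g h ((c , u) ∷ p) = trans (cong (c *ℚ (g u +ℚ h u) +ℚ_) (dot-add g h p))
  (solve 5 (λ c x y a b → c :* (x :+ y) :+ (a :+ b) := c :* x :+ a :+ (c :* y :+ b)) refl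
     c (g u) (h u) (dot g p) (dot h p))

dot-mul : ∀ g c p → dot (λ u → c *ℚ g u) p ≡ c *ℚ dot g p
dot-mul g c [] = sym (ℚP.*-zeroʳ c)
dot-mul g c ((d , u) ∷ p) = trans (cong (d *ℚ (c *ℚ g u) +ℚ_) (dot-mul g c p))
  (solve 4 (λ c d x y → d :* (c :* x) :+ c :* y := c :* (d :* x :+ y)) refl c d (g u) (dot g p))

dot-zero : ∀ p → dot (λ _ → 0ℚ) p ≡ 0ℚ
dot-zero [] = refl
dot-zero ((c , u) ∷ p) = trans (cong (c *ℚ 0ℚ +ℚ_) (dot-zero p))
  (solve 1 (λ c → c :* con 0ℚ :+ con 0ℚ := con 0ℚ) refl c)

dot-swap : ∀ (H : Word → Word → ℚ) p q →
  dot (λ u → dot (λ v → H u v) q) p ≡ dot (λ v → dot (λ u → H u v) p) q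
dot-swap H [] q = sym (dot-zero q)
dot-swap H ((c , u) ∷ p) q = begin
    c *ℚ dot (λ v → H u v) q +ℚ dot (λ u → dot (λ v → H u v) q) p
      ≡⟨ cong₂ _+ℚ_ (sym (dot-mul (λ v → H u v) c q)) (dot-swap H p q) ⟩
    dot (λ v → c *ℚ H u v) q +ℚ dot (λ v → dot (λ u → H u v) p) q
      ≡⟨ sym (dot-add _ _ q) ⟩
    dot (λ v → c *ℚ H u v +ℚ dot (λ u → H u v) p) q ∎
  where open ≡-Reasoning

-- Coefficientwise equality, wrapped in a record so that Agda can infer
-- its polynomial arguments; it forms a setoid used for equational reasoning.
record _≋_ (p q : Poly) : Set where
  constructor ≋i
  field ≋o : p ≈ q
open _≋_ public

infix 4 _≋_

≋-refl : ∀ {p} → p ≋ p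
≋-refl = ≋i (λ w → refl)

≋-sym : ∀ {p q} → p ≋ q → q ≋ p
≋-sym e = ≋i (λ w → sym (≋o e w))

≋-trans : ∀ {p q r} → p ≋ q → q ≋ r → p ≋ r
≋-trans e f = ≋i (λ w → trans (≋o e w) (≋o f w))

≡⇒≋ : ∀ {p q} → p ≡ q → p ≋ q
≡⇒≋ refl = ≋-refl

PolySetoid : Setoid _ _
PolySetoid = record { Carrier = Poly ; _≈_ = _≋_
  ; isEquivalence = record { refl = ≋-refl ; sym = ≋-sym ; trans = ≋-trans } }

module PolyReasoning = SetoidReasoning PolySetoid

⟦_⟧ : Word → Poly
⟦ w ⟧ = (1ℚ , w) ∷ []

neg : Poly → Poly
neg = scale (- 1ℚ)

_⊖_ : Poly → Poly → Poly
p ⊖ q = p ⊕ neg q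

infixl 6 _⊖_

coeff-neg : ∀ w p → coeff w (neg p) ≡ - coeff w p
coeff-neg w p = trans (coeff-scale w (- 1ℚ) p) (solve 1 (λ x → con (- 1ℚ) :* x := :- x) refl (coeff w p))

⊕-cong : ∀ {p p' q q'} → p ≋ p' → q ≋ q' → (p ⊕ q) ≋ (p' ⊕ q')
⊕-cong {p} {p'} {q} {q'} e f = ≋i λ w →
  trans (coeff-++ w p q) (trans (cong₂ _+ℚ_ (≋o e w) (≋o f w)) (sym (coeff-++ w p' q')))

scale-cong : ∀ c {p q} → p ≋ q → scale c p ≋ scale c q
scale-cong c {p} {q} e = ≋i λ w →
  trans (coeff-scale w c p) (trans (cong (c *ℚ_) (≋o e w)) (sym (coeff-scale w c q)))

neg-cong : ∀ {p q} → p ≋ q → neg p ≋ neg q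
neg-cong = scale-cong (- 1ℚ)

⊕-comm : ∀ p q → (p ⊕ q) ≋ (q ⊕ p)
⊕-comm p q = ≋i λ w → trans (coeff-++ w p q) (trans (ℚP.+-comm (coeff w p) (coeff w q)) (sym (coeff-++ w q p)))

⊕-assoc : ∀ p q r → ((p ⊕ q) ⊕ r) ≋ (p ⊕ (q ⊕ r))
⊕-assoc p q r = ≡⇒≋ (LP.++-assoc p q r)

⊕-identityʳ : ∀ p → (p ⊕ zeroP) ≋ p
⊕-identityʳ p = ≡⇒≋ (LP.++-identityʳ p)

scale-scale : ∀ c d p → scale c (scale d p) ≋ scale (c *ℚ d) p
scale-scale c d p = ≋i λ w → trans (coeff-scale w c (scale d p)) (trans (cong (c *ℚ_) (coeff-scale w d p))
  (trans (sym (ℚP.*-assoc c d _)) (sym (coeff-scale w (c *ℚ d) p))))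

scale-⊕ : ∀ c p q → scale c (p ⊕ q) ≋ (scale c p ⊕ scale c q)
scale-⊕ c p q = ≡⇒≋ (LP.map-++ _ p q)

scale-one : ∀ p → scale 1ℚ p ≋ p
scale-one p = ≋i λ w → trans (coeff-scale w 1ℚ p) (ℚP.*-identityˡ _)

scale-≡ : ∀ {c d} p → c ≡ d → scale c p ≋ scale d p
scale-≡ p refl = ≋-refl

-- Identities between ℚ-linear combinations of polynomials are reduced to
-- identities of their coefficients, which the ring solver then decides.
data LinExpr : Set where
  atom : Poly → LinExpr
  _⊕e_ : LinExpr → LinExpr → LinExpr
  nege : LinExpr → LinExpr
  scalee : ℚ → LinExpr → LinExpr

evalE : LinExpr → Poly
evalE (atom p) = p
evalE (a ⊕e b) = evalE a ⊕ evalE b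
evalE (nege a) = neg (evalE a)
evalE (scalee c a) = scale c (evalE a)

coeffE : Word → LinExpr → ℚ
coeffE w (atom p) = coeff w p
coeffE w (a ⊕e b) = coeffE w a +ℚ coeffE w b
coeffE w (nege a) = - coeffE w a
coeffE w (scalee c a) = c *ℚ coeffE w a

coeff-evalE : ∀ w e → coeff w (evalE e) ≡ coeffE w e
coeff-evalE w (atom p) = refl
coeff-evalE w (a ⊕e b) = trans (coeff-++ w (evalE a) (evalE b)) (cong₂ _+ℚ_ (coeff-evalE w a) (coeff-evalE w b))
coeff-evalE w (nege a) = trans (coeff-neg w (evalE a)) (cong -_ (coeff-evalE w a))
coeff-evalE w (scalee c a) = trans (coeff-scale w c (evalE a)) (cong (c *ℚ_) (coeff-evalE w a))

by-coefficients : ∀ e₁ e₂ → (∀ w → coeffE w e₁ ≡ coeffE w e₂) → evalE e₁ ≋ evalE e₂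
by-coefficients e₁ e₂ h = ≋i λ w → trans (coeff-evalE w e₁) (trans (h w) (sym (coeff-evalE w e₂)))

⊕-interchange : ∀ a b c d → ((a ⊕ b) ⊕ (c ⊕ d)) ≋ ((a ⊕ c) ⊕ (b ⊕ d))
⊕-interchange a b c d =
  by-coefficients ((atom a ⊕e atom b) ⊕e (atom c ⊕e atom d)) ((atom a ⊕e atom c) ⊕e (atom b ⊕e atom d))
    (λ w → solve 4 (λ x y z t → (x :+ y) :+ (z :+ t) := (x :+ z) :+ (y :+ t)) refl
             (coeff w a) (coeff w b) (coeff w c) (coeff w d))

sumP-cong : ∀ {A : Set} (f g : A → Poly) (L : List A) → (∀ t → f t ≋ g t) → sumP (map f L) ≋ sumP (map g L)
sumP-cong f g [] e = ≋-refl
sumP-cong f g (t ∷ L) e = ⊕-cong (e t) (sumP-cong f g L e)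

sumP-++ : ∀ A B → sumP (A ++ B) ≋ (sumP A ⊕ sumP B)
sumP-++ [] B = ≋-refl
sumP-++ (x ∷ A) B = ≋-trans (⊕-cong (≋-refl {x}) (sumP-++ A B)) (≋-sym (⊕-assoc x (sumP A) (sumP B)))

sumP-scale : ∀ {A : Set} (c : ℚ) (g : A → Poly) (L : List A) →
  sumP (map (λ t → scale c (g t)) L) ≋ scale c (sumP (map g L))
sumP-scale c g [] = ≋-refl
sumP-scale c g (t ∷ L) = ≋-trans (⊕-cong (≋-refl {scale c (g t)}) (sumP-scale c g L))
  (≋-sym (scale-⊕ c (g t) (sumP (map g L))))

neg-sumP : ∀ {A : Set} (c : A → ℚ) (g : A → Poly) (L : List A) →
  neg (sumP (map (λ t → scale (- c t) (g t)) L)) ≋ sumP (map (λ t → scale (c t) (g t)) L)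
neg-sumP c g [] = ≋-refl
neg-sumP c g (t ∷ L) = ≋-trans (scale-⊕ (- 1ℚ) (scale (- c t) (g t)) _)
  (⊕-cong (≋-trans (scale-scale (- 1ℚ) (- c t) (g t))
             (scale-≡ (g t) (solve 1 (λ x → con (- 1ℚ) :* (:- x) := x) refl (c t))))
          (neg-sumP c g L))

ext : (Word → Poly) → Poly → Poly
ext f [] = []
ext f ((c , u) ∷ p) = scale c (f u) ++ ext f p

coeff-ext : ∀ w f p → coeff w (ext f p) ≡ dot (λ u → coeff w (f u)) p
coeff-ext w f [] = refl
coeff-ext w f ((c , u) ∷ p) = trans (coeff-++ w (scale c (f u)) (ext f p))
  (cong₂ _+ℚ_ (coeff-scale w c (f u)) (coeff-ext w f p))

dot-single : ∀ w p → dot (λ u → coeff w ⟦ u ⟧) p ≡ coeff w p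
dot-single w [] = refl
dot-single w ((c , u) ∷ p) with ≡-dec _≟B_ w u
... | yes _ = cong₂ _+ℚ_ (solve 1 (λ c → c :* (con 1ℚ :+ con 0ℚ) := c) refl c) (dot-single w p)
... | no _ = trans (cong₂ _+ℚ_ (ℚP.*-zeroʳ c) (dot-single w p)) (ℚP.+-identityˡ _)

ext-resp : ∀ f {p q} → p ≋ q → ext f p ≋ ext f q
ext-resp f {p} {q} e = ≋i λ w →
  trans (coeff-ext w f p) (trans (dot-resp _ p q (≋o e)) (sym (coeff-ext w f q)))

ext-cong : ∀ {f g} p → (∀ u → f u ≋ g u) → ext f p ≋ ext g p
ext-cong {f} {g} p e = ≋i λ w →
  trans (coeff-ext w f p) (trans (dot-cong p (λ u → ≋o (e u) w)) (sym (coeff-ext w g p)))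

ext-cong-All : ∀ {f g} p → All (λ t → f (proj₂ t) ≋ g (proj₂ t)) p → ext f p ≋ ext g p
ext-cong-All {f} {g} p es = ≋i λ w →
  trans (coeff-ext w f p) (trans (dot-cong-All p (All.map (λ e → ≋o e w) es)) (sym (coeff-ext w g p)))

ext-⊕ : ∀ f p q → ext f (p ⊕ q) ≋ (ext f p ⊕ ext f q)
ext-⊕ f [] q = ≋-refl
ext-⊕ f ((c , u) ∷ p) q =
  ≋-trans (⊕-cong (≋-refl {scale c (f u)}) (ext-⊕ f p q)) (≋-sym (⊕-assoc (scale c (f u)) _ _))

ext-scale : ∀ f c p → ext f (scale c p) ≋ scale c (ext f p)
ext-scale f c p = ≋i λ w → trans (coeff-ext w f (scale c p)) (trans (dot-scale _ c p)
  (trans (cong (c *ℚ_) (sym (coeff-ext w f p))) (sym (coeff-scale w c (ext f p)))))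

ext-single : ∀ f u → ext f ⟦ u ⟧ ≋ f u
ext-single f u = ≋i λ w → trans (coeff-ext w f ⟦ u ⟧)
  (solve 1 (λ x → con 1ℚ :* x :+ con 0ℚ := x) refl (coeff w (f u)))

ext-id : ∀ p → ext ⟦_⟧ p ≋ p
ext-id p = ≋i λ w → trans (coeff-ext w ⟦_⟧ p) (dot-single w p)

ext-ext : ∀ f g p → ext f (ext g p) ≋ ext (λ u → ext f (g u)) p
ext-ext f g [] = ≋-refl
ext-ext f g ((c , u) ∷ p) = ≋-trans (ext-⊕ f (scale c (g u)) (ext g p))
  (⊕-cong (ext-scale f c (g u)) (ext-ext f g p))

ext-fun-⊕ : ∀ f g p → ext (λ u → f u ⊕ g u) p ≋ (ext f p ⊕ ext g p)
ext-fun-⊕ f g p = ≋i λ w → begin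
    coeff w (ext (λ u → f u ⊕ g u) p) ≡⟨ coeff-ext w _ p ⟩
    dot (λ u → coeff w (f u ⊕ g u)) p ≡⟨ dot-cong p (λ u → coeff-++ w (f u) (g u)) ⟩
    dot (λ u → coeff w (f u) +ℚ coeff w (g u)) p ≡⟨ dot-add _ _ p ⟩
    dot (λ u → coeff w (f u)) p +ℚ dot (λ u → coeff w (g u)) p
      ≡⟨ sym (cong₂ _+ℚ_ (coeff-ext w f p) (coeff-ext w g p)) ⟩
    coeff w (ext f p) +ℚ coeff w (ext g p) ≡⟨ sym (coeff-++ w (ext f p) (ext g p)) ⟩
    coeff w (ext f p ⊕ ext g p) ∎
  where open ≡-Reasoning

ext-fun-scale : ∀ f c p → ext (λ u → scale c (f u)) p ≋ scale c (ext f p)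
ext-fun-scale f c p = ≋i λ w → begin
    coeff w (ext (λ u → scale c (f u)) p) ≡⟨ coeff-ext w _ p ⟩
    dot (λ u → coeff w (scale c (f u))) p ≡⟨ dot-cong p (λ u → coeff-scale w c (f u)) ⟩
    dot (λ u → c *ℚ coeff w (f u)) p ≡⟨ dot-mul _ c p ⟩
    c *ℚ dot (λ u → coeff w (f u)) p ≡⟨ cong (c *ℚ_) (sym (coeff-ext w f p)) ⟩
    c *ℚ coeff w (ext f p) ≡⟨ sym (coeff-scale w c (ext f p)) ⟩
    coeff w (scale c (ext f p)) ∎
  where open ≡-Reasoning

ext-fun-zero : ∀ p → ext (λ _ → []) p ≋ []
ext-fun-zero p = ≋i λ w → trans (coeff-ext w _ p) (dot-zero p)

ext-swap : ∀ (H : Word → Word → Poly) p q →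
  ext (λ u → ext (λ v → H u v) q) p ≋ ext (λ v → ext (λ u → H u v) p) q
ext-swap H p q = ≋i λ w →
  trans (coeff-ext w _ p) (trans (dot-cong p (λ u → coeff-ext w (H u) q))
  (trans (dot-swap (λ u v → coeff w (H u v)) p q)
  (sym (trans (coeff-ext w _ q) (dot-cong q (λ v → coeff-ext w (λ u → H u v) p))))))

Linear : (Poly → Poly) → Set
Linear F = ∀ P → F P ≋ ext (λ w → F ⟦ w ⟧) P

lin-resp : ∀ {F} → Linear F → ∀ {P Q} → P ≋ Q → F P ≋ F Q
lin-resp {F} L {P} {Q} e = ≋-trans (L P) (≋-trans (ext-resp _ e) (≋-sym (L Q)))

lin-ext : ∀ {F} → Linear F → ∀ h W → F (ext h W) ≋ ext (λ w → F (h w)) W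
lin-ext {F} L h W = ≋-trans (L (ext h W)) (≋-trans (ext-ext _ h W) (ext-cong W (λ u → ≋-sym (L (h u)))))

lin-⊕ : ∀ {F} → Linear F → ∀ P Q → F (P ⊕ Q) ≋ (F P ⊕ F Q)
lin-⊕ {F} L P Q = ≋-trans (L (P ⊕ Q)) (≋-trans (ext-⊕ _ P Q) (⊕-cong (≋-sym (L P)) (≋-sym (L Q))))

ext-linear : ∀ h → Linear (ext h)
ext-linear h P = ext-cong P (λ u → ≋-sym (ext-single h u))

lin-∘ : ∀ {F G} → Linear F → Linear G → Linear (λ P → F (G P))
lin-∘ {F} {G} LF LG P = ≋-trans (lin-resp LF (LG P)) (lin-ext LF _ P)

lin-id : Linear (λ P → P)
lin-id P = ≋-sym (ext-id P)

lin-plus : ∀ {F G} → Linear F → Linear G → Linear (λ P → F P ⊕ G P)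
lin-plus {F} {G} LF LG P = ≋-trans (⊕-cong (LF P) (LG P)) (≋-sym (ext-fun-⊕ _ _ P))

lin-zero : Linear (λ _ → [])
lin-zero P = ≋-sym (ext-fun-zero P)

lin-scaling : ∀ c → Linear (scale c)
lin-scaling c P = ≋-sym (≋-trans (ext-fun-scale ⟦_⟧ c P) (scale-cong c (ext-id P)))

lin-agree : ∀ {F G} → Linear F → Linear G → (∀ w → F ⟦ w ⟧ ≋ G ⟦ w ⟧) → ∀ P → F P ≋ G P
lin-agree {F} {G} LF LG e P = ≋-trans (LF P) (≋-trans (ext-cong P e) (≋-sym (LG P)))

_◃_ : Bool → Poly → Poly
a ◃ P = (a ∷ []) · P

infixr 25 _◃_

lin-pre : ∀ u → Linear (u ·_)
lin-pre u [] = ≋-refl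
lin-pre u ((c , w) ∷ p) =
  ⊕-cong {(c , u ++ w) ∷ []} {(c *ℚ 1ℚ , u ++ w) ∷ []}
    (≡⇒≋ (cong (λ d → (d , u ++ w) ∷ []) (sym (ℚP.*-identityʳ c)))) (lin-pre u p)

pre-cong : ∀ u {P Q} → P ≋ Q → u · P ≋ u · Q
pre-cong u = lin-resp (lin-pre u)

pre-⊕ : ∀ u P Q → u · (P ⊕ Q) ≋ ((u · P) ⊕ (u · Q))
pre-⊕ u P Q = ≡⇒≋ (LP.map-++ _ P Q)

pre-pre : ∀ u v P → u · (v · P) ≡ (u ++ v) · P
pre-pre u v [] = refl
pre-pre u v ((c , w) ∷ P) = cong₂ _∷_ (cong (c ,_) (sym (LP.++-assoc u v w))) (pre-pre u v P)

pre-[] : ∀ P → [] · P ≡ P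
pre-[] [] = refl
pre-[] ((c , w) ∷ P) = cong ((c , w) ∷_) (pre-[] P)

shuffleExt : Poly → Poly → Poly
shuffleExt P Q = ext (λ u → ext (λ v → shw u v) Q) P

⧢-single : ∀ c u Q → (((c , u) ∷ []) ⧢ Q) ≋ scale c (ext (shw u) Q)
⧢-single c u [] = ≋-refl
⧢-single c u ((d , v) ∷ Q) = ≋-trans (≡⇒≋ (LP.++-assoc (scale (c *ℚ d) (shw u v)) _ []))
  (≋-trans (⊕-cong (≋-sym (scale-scale c d (shw u v))) (⧢-single c u Q))
  (≋-sym (scale-⊕ c (scale d (shw u v)) (ext (shw u) Q))))

⧢-shuffleExt : ∀ P Q → (P ⧢ Q) ≋ shuffleExt P Q
⧢-shuffleExt [] Q = ≋-refl
⧢-shuffleExt ((c , u) ∷ P) Q = ≋-trans (≡⇒≋ (cong (_++ (P ⧢ Q)) (sym (LP.++-identityʳ _))))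
  (⊕-cong (⧢-single c u Q) (⧢-shuffleExt P Q))

⧢-words : ∀ u v → (⟦ u ⟧ ⧢ ⟦ v ⟧) ≋ shw u v
⧢-words u v = ≋-trans (⧢-shuffleExt ⟦ u ⟧ ⟦ v ⟧)
  (≋-trans (ext-single (λ u → ext (shw u) ⟦ v ⟧) u) (ext-single (shw u) v))

lin-⧢ˡ : ∀ Q → Linear (λ P → P ⧢ Q)
lin-⧢ˡ Q P = ≋-trans (⧢-shuffleExt P Q)
  (ext-cong P (λ u → ≋-sym (≋-trans (⧢-shuffleExt ⟦ u ⟧ Q) (ext-single (λ u → ext (shw u) Q) u))))

lin-⧢ʳ : ∀ P → Linear (λ Q → P ⧢ Q)
lin-⧢ʳ P Q = ≋-trans (⧢-shuffleExt P Q) (≋-trans (ext-swap shw P Q)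
  (ext-cong Q (λ v → ≋-sym (≋-trans (⧢-shuffleExt P ⟦ v ⟧) (ext-cong P (λ u → ext-single (shw u) v))))))

⧢-congˡ : ∀ {P P'} Q → P ≋ P' → (P ⧢ Q) ≋ (P' ⧢ Q)
⧢-congˡ Q = lin-resp (lin-⧢ˡ Q)

⧢-congʳ : ∀ P {Q Q'} → Q ≋ Q' → (P ⧢ Q) ≋ (P ⧢ Q')
⧢-congʳ P = lin-resp (lin-⧢ʳ P)

bilin-agree : ∀ (F G : Poly → Poly → Poly) →
  (∀ Q → Linear (λ P → F P Q)) → (∀ Q → Linear (λ P → G P Q)) →
  (∀ u → Linear (F ⟦ u ⟧)) → (∀ u → Linear (G ⟦ u ⟧)) →
  (∀ u v → F ⟦ u ⟧ ⟦ v ⟧ ≋ G ⟦ u ⟧ ⟦ v ⟧) → ∀ P Q → F P Q ≋ G P Q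
bilin-agree F G LF LG LF' LG' e P Q =
  lin-agree (LF Q) (LG Q) (λ u → lin-agree (LF' u) (LG' u) (λ v → e u v) Q) P

shw-[]ʳ : ∀ u → shw u [] ≋ ⟦ u ⟧
shw-[]ʳ [] = ≋-refl
shw-[]ʳ (a ∷ u) = ≋-refl

⧢-identityʳ : ∀ P → (P ⧢ oneP) ≋ P
⧢-identityʳ = lin-agree (lin-⧢ˡ oneP) lin-id (λ u → ≋-trans (⧢-words u []) (shw-[]ʳ u))

⧢-identityˡ : ∀ P → (oneP ⧢ P) ≋ P
⧢-identityˡ = lin-agree (lin-⧢ʳ oneP) lin-id (λ u → ⧢-words [] u)

shw-comm : ∀ u v → shw u v ≋ shw v u
shw-comm [] [] = ≋-refl
shw-comm [] (b ∷ v) = ≋-refl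
shw-comm (a ∷ u) [] = ≋-refl
shw-comm (a ∷ u) (b ∷ v) =
  ≋-trans (⊕-cong (pre-cong (a ∷ []) (shw-comm u (b ∷ v))) (pre-cong (b ∷ []) (shw-comm (a ∷ u) v)))
    (⊕-comm ((a ∷ []) · shw (b ∷ v) u) ((b ∷ []) · shw v (a ∷ u)))

⧢-comm : ∀ P Q → (P ⧢ Q) ≋ (Q ⧢ P)
⧢-comm = bilin-agree _⧢_ (λ P Q → Q ⧢ P) lin-⧢ˡ lin-⧢ʳ (λ u → lin-⧢ʳ ⟦ u ⟧) (λ u → lin-⧢ˡ ⟦ u ⟧)
  (λ u v → ≋-trans (⧢-words u v) (≋-trans (shw-comm u v) (≋-sym (⧢-words v u))))

⧢-letters : ∀ a b P R → ((a ◃ P) ⧢ (b ◃ R)) ≋ (a ◃ (P ⧢ (b ◃ R)) ⊕ b ◃ ((a ◃ P) ⧢ R))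
⧢-letters a b = bilin-agree (λ P R → (a ◃ P) ⧢ (b ◃ R)) (λ P R → a ◃ (P ⧢ (b ◃ R)) ⊕ b ◃ ((a ◃ P) ⧢ R))
  (λ R → lin-∘ {λ X → X ⧢ (b ◃ R)} {a ◃_} (lin-⧢ˡ (b ◃ R)) (lin-pre (a ∷ [])))
  (λ R → lin-plus {λ P → a ◃ (P ⧢ (b ◃ R))} {λ P → b ◃ ((a ◃ P) ⧢ R)}
     (lin-∘ {a ◃_} {λ P → P ⧢ (b ◃ R)} (lin-pre (a ∷ [])) (lin-⧢ˡ (b ◃ R)))
     (lin-∘ {b ◃_} {λ P → (a ◃ P) ⧢ R} (lin-pre (b ∷ [])) (lin-∘ {λ X → X ⧢ R} {a ◃_} (lin-⧢ˡ R) (lin-pre (a ∷ [])))))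
  (λ u → lin-∘ {λ X → ⟦ a ∷ u ⟧ ⧢ X} {b ◃_} (lin-⧢ʳ ⟦ a ∷ u ⟧) (lin-pre (b ∷ [])))
  (λ u → lin-plus {λ R → a ◃ (⟦ u ⟧ ⧢ (b ◃ R))} {λ R → b ◃ (⟦ a ∷ u ⟧ ⧢ R)}
     (lin-∘ {a ◃_} {λ R → ⟦ u ⟧ ⧢ (b ◃ R)} (lin-pre (a ∷ []))
        (lin-∘ {λ X → ⟦ u ⟧ ⧢ X} {b ◃_} (lin-⧢ʳ ⟦ u ⟧) (lin-pre (b ∷ []))))
     (lin-∘ {b ◃_} {λ R → ⟦ a ∷ u ⟧ ⧢ R} (lin-pre (b ∷ [])) (lin-⧢ʳ ⟦ a ∷ u ⟧)))
  (λ u v → ≋-trans (⧢-words (a ∷ u) (b ∷ v))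
     (⊕-cong (pre-cong (a ∷ []) (≋-sym (⧢-words u (b ∷ v))))
             (pre-cong (b ∷ []) (≋-sym (⧢-words (a ∷ u) v)))))

-- Both bracketings of aU ⧢ bV ⧢ cW expand, by the letter
-- recursion, to the same combination a(…) + b(…) + c(…) of shorter
-- shuffles; for words these agree by induction on the total length.

threeLetters : Bool → Bool → Bool → Poly → Poly → Poly → Poly
threeLetters a b c A B C = (a ◃ A ⊕ b ◃ B) ⊕ c ◃ C

⧢-expand-right : ∀ a b c U V W →
  ((a ◃ U) ⧢ ((b ◃ V) ⧢ (c ◃ W))) ≋
  threeLetters a b c (U ⧢ ((b ◃ V) ⧢ (c ◃ W))) ((a ◃ U) ⧢ (V ⧢ (c ◃ W))) ((a ◃ U) ⧢ ((b ◃ V) ⧢ W))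
⧢-expand-right a b c U V W = begin
    aU ⧢ (bV ⧢ cW) ≈⟨ ⧢-congʳ aU (⧢-letters b c V W) ⟩
    aU ⧢ (b ◃ Z₁ ⊕ c ◃ Z₂) ≈⟨ lin-⊕ (lin-⧢ʳ aU) (b ◃ Z₁) (c ◃ Z₂) ⟩
    (aU ⧢ (b ◃ Z₁)) ⊕ (aU ⧢ (c ◃ Z₂)) ≈⟨ ⊕-cong (⧢-letters a b U Z₁) (⧢-letters a c U Z₂) ⟩
    (a ◃ (U ⧢ (b ◃ Z₁)) ⊕ b ◃ (aU ⧢ Z₁)) ⊕ (a ◃ (U ⧢ (c ◃ Z₂)) ⊕ c ◃ (aU ⧢ Z₂))
      ≈⟨ ⊕-interchange (a ◃ (U ⧢ (b ◃ Z₁))) (b ◃ (aU ⧢ Z₁)) (a ◃ (U ⧢ (c ◃ Z₂))) (c ◃ (aU ⧢ Z₂)) ⟩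
    (a ◃ (U ⧢ (b ◃ Z₁)) ⊕ a ◃ (U ⧢ (c ◃ Z₂))) ⊕ (b ◃ (aU ⧢ Z₁) ⊕ c ◃ (aU ⧢ Z₂))
      ≈⟨ ≋-sym (⊕-assoc (a ◃ (U ⧢ (b ◃ Z₁)) ⊕ a ◃ (U ⧢ (c ◃ Z₂))) (b ◃ (aU ⧢ Z₁)) (c ◃ (aU ⧢ Z₂))) ⟩
    ((a ◃ (U ⧢ (b ◃ Z₁)) ⊕ a ◃ (U ⧢ (c ◃ Z₂))) ⊕ b ◃ (aU ⧢ Z₁)) ⊕ c ◃ (aU ⧢ Z₂)
      ≈⟨ ⊕-cong (⊕-cong (≋-sym collectA) (≋-refl {b ◃ (aU ⧢ Z₁)})) (≋-refl {c ◃ (aU ⧢ Z₂)}) ⟩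
    threeLetters a b c (U ⧢ (bV ⧢ cW)) (aU ⧢ Z₁) (aU ⧢ Z₂) ∎
  where
  open PolyReasoning
  aU = a ◃ U
  bV = b ◃ V
  cW = c ◃ W
  Z₁ = V ⧢ cW
  Z₂ = bV ⧢ W
  collectA : a ◃ (U ⧢ (bV ⧢ cW)) ≋ (a ◃ (U ⧢ (b ◃ Z₁)) ⊕ a ◃ (U ⧢ (c ◃ Z₂)))
  collectA = ≋-trans (pre-cong (a ∷ []) (≋-trans (⧢-congʳ U (⧢-letters b c V W)) (lin-⊕ (lin-⧢ʳ U) (b ◃ Z₁) (c ◃ Z₂))))
               (pre-⊕ (a ∷ []) (U ⧢ (b ◃ Z₁)) (U ⧢ (c ◃ Z₂)))

⧢-expand-left : ∀ a b c U V W →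
  (((a ◃ U) ⧢ (b ◃ V)) ⧢ (c ◃ W)) ≋
  threeLetters a b c ((U ⧢ (b ◃ V)) ⧢ (c ◃ W)) (((a ◃ U) ⧢ V) ⧢ (c ◃ W)) (((a ◃ U) ⧢ (b ◃ V)) ⧢ W)
⧢-expand-left a b c U V W = begin
    (aU ⧢ bV) ⧢ cW ≈⟨ ⧢-congˡ cW (⧢-letters a b U V) ⟩
    (a ◃ X ⊕ b ◃ Y) ⧢ cW ≈⟨ lin-⊕ (lin-⧢ˡ cW) (a ◃ X) (b ◃ Y) ⟩
    ((a ◃ X) ⧢ cW) ⊕ ((b ◃ Y) ⧢ cW) ≈⟨ ⊕-cong (⧢-letters a c X W) (⧢-letters b c Y W) ⟩
    (a ◃ (X ⧢ cW) ⊕ c ◃ ((a ◃ X) ⧢ W)) ⊕ (b ◃ (Y ⧢ cW) ⊕ c ◃ ((b ◃ Y) ⧢ W))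
      ≈⟨ ⊕-interchange (a ◃ (X ⧢ cW)) (c ◃ ((a ◃ X) ⧢ W)) (b ◃ (Y ⧢ cW)) (c ◃ ((b ◃ Y) ⧢ W)) ⟩
    (a ◃ (X ⧢ cW) ⊕ b ◃ (Y ⧢ cW)) ⊕ (c ◃ ((a ◃ X) ⧢ W) ⊕ c ◃ ((b ◃ Y) ⧢ W))
      ≈⟨ ⊕-cong (≋-refl {a ◃ (X ⧢ cW) ⊕ b ◃ (Y ⧢ cW)}) (≋-sym collectC) ⟩
    threeLetters a b c (X ⧢ cW) (Y ⧢ cW) ((aU ⧢ bV) ⧢ W) ∎
  where
  open PolyReasoning
  aU = a ◃ U
  bV = b ◃ V
  cW = c ◃ W
  X = U ⧢ bV
  Y = aU ⧢ V
  collectC : c ◃ ((aU ⧢ bV) ⧢ W) ≋ (c ◃ ((a ◃ X) ⧢ W) ⊕ c ◃ ((b ◃ Y) ⧢ W))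
  collectC = ≋-trans (pre-cong (c ∷ []) (≋-trans (⧢-congˡ W (⧢-letters a b U V)) (lin-⊕ (lin-⧢ˡ W) (a ◃ X) (b ◃ Y))))
               (pre-⊕ (c ∷ []) ((a ◃ X) ⧢ W) ((b ◃ Y) ⧢ W))

threeLetters-cong : ∀ a b c {A A' B B' C C'} → A ≋ A' → B ≋ B' → C ≋ C' →
  threeLetters a b c A B C ≋ threeLetters a b c A' B' C'
threeLetters-cong a b c eA eB eC =
  ⊕-cong (⊕-cong (pre-cong (a ∷ []) eA) (pre-cong (b ∷ []) eB)) (pre-cong (c ∷ []) eC)

⧢-assoc-words : ∀ u v w → ((⟦ u ⟧ ⧢ ⟦ v ⟧) ⧢ ⟦ w ⟧) ≋ (⟦ u ⟧ ⧢ (⟦ v ⟧ ⧢ ⟦ w ⟧))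
⧢-assoc-words [] v w =
  ≋-trans (⧢-congˡ ⟦ w ⟧ (⧢-identityˡ ⟦ v ⟧)) (≋-sym (⧢-identityˡ (⟦ v ⟧ ⧢ ⟦ w ⟧)))
⧢-assoc-words (a ∷ u) [] w =
  ≋-trans (⧢-congˡ ⟦ w ⟧ (⧢-identityʳ ⟦ a ∷ u ⟧)) (⧢-congʳ ⟦ a ∷ u ⟧ (≋-sym (⧢-identityˡ ⟦ w ⟧)))
⧢-assoc-words (a ∷ u) (b ∷ v) [] =
  ≋-trans (⧢-identityʳ (⟦ a ∷ u ⟧ ⧢ ⟦ b ∷ v ⟧)) (⧢-congʳ ⟦ a ∷ u ⟧ (≋-sym (⧢-identityʳ ⟦ b ∷ v ⟧)))
⧢-assoc-words (a ∷ u) (b ∷ v) (c ∷ w) =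
  ≋-trans (⧢-expand-left a b c ⟦ u ⟧ ⟦ v ⟧ ⟦ w ⟧)
    (≋-trans (threeLetters-cong a b c (⧢-assoc-words u (b ∷ v) (c ∷ w))
                                      (⧢-assoc-words (a ∷ u) v (c ∷ w))
                                      (⧢-assoc-words (a ∷ u) (b ∷ v) w))
             (≋-sym (⧢-expand-right a b c ⟦ u ⟧ ⟦ v ⟧ ⟦ w ⟧)))

⧢-assoc : ∀ P Q R → ((P ⧢ Q) ⧢ R) ≋ (P ⧢ (Q ⧢ R))
⧢-assoc P Q R =
  lin-agree {λ P → (P ⧢ Q) ⧢ R} {λ P → P ⧢ (Q ⧢ R)}
    (lin-∘ {λ X → X ⧢ R} {λ X → X ⧢ Q} (lin-⧢ˡ R) (lin-⧢ˡ Q)) (lin-⧢ˡ (Q ⧢ R))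
    (λ u → lin-agree {λ Q → (⟦ u ⟧ ⧢ Q) ⧢ R} {λ Q → ⟦ u ⟧ ⧢ (Q ⧢ R)}
       (lin-∘ {λ X → X ⧢ R} {λ X → ⟦ u ⟧ ⧢ X} (lin-⧢ˡ R) (lin-⧢ʳ ⟦ u ⟧))
       (lin-∘ {λ X → ⟦ u ⟧ ⧢ X} {λ X → X ⧢ R} (lin-⧢ʳ ⟦ u ⟧) (lin-⧢ˡ R))
       (λ v → lin-agree {λ R → (⟦ u ⟧ ⧢ ⟦ v ⟧) ⧢ R} {λ R → ⟦ u ⟧ ⧢ (⟦ v ⟧ ⧢ R)}
          (lin-⧢ʳ (⟦ u ⟧ ⧢ ⟦ v ⟧)) (lin-∘ {λ X → ⟦ u ⟧ ⧢ X} {λ X → ⟦ v ⟧ ⧢ X} (lin-⧢ʳ ⟦ u ⟧) (lin-⧢ʳ ⟦ v ⟧))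
          (λ w → ⧢-assoc-words u v w) R) Q) P

-- The operator T.  For Q ∈ 𝔥 and a word w = w₁w₂⋯,
--   T Q w = Σ_i (-1)^i [w_{i+1} = x₁] (w_i ⋯ w₁ Q) ⧢ (w_{i+2} ⋯),
-- defined by peeling off the first letter of w and pushing it onto Q.

onX1 : Bool → Poly → Poly
onX1 true P = P
onX1 false P = []

T : Poly → Word → Poly
T Q [] = []
T Q (c ∷ w) = onX1 c (Q ⧢ ⟦ w ⟧) ⊕ neg (T (c ◃ Q) w)

Tlin : Poly → Poly → Poly
Tlin Q = ext (T Q)

lin-onX1 : ∀ c {F} → Linear F → Linear (λ P → onX1 c (F P))
lin-onX1 true L = L
lin-onX1 false L = lin-zero

onX1-cong : ∀ c {P Q} → P ≋ Q → onX1 c P ≋ onX1 c Q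
onX1-cong true e = e
onX1-cong false e = ≋-refl

onX1-⊕ : ∀ c P Q → onX1 c (P ⊕ Q) ≋ (onX1 c P ⊕ onX1 c Q)
onX1-⊕ true P Q = ≋-refl
onX1-⊕ false P Q = ≋-refl

lin-neg : Linear neg
lin-neg = lin-scaling (- 1ℚ)

T-linear : ∀ w → Linear (λ Q → T Q w)
T-linear [] = lin-zero
T-linear (c ∷ w) = lin-plus {λ Q → onX1 c (Q ⧢ ⟦ w ⟧)} {λ Q → neg (T (c ◃ Q) w)}
  (lin-onX1 c {λ Q → Q ⧢ ⟦ w ⟧} (lin-⧢ˡ ⟦ w ⟧))
  (lin-∘ {neg} {λ Q → T (c ◃ Q) w} lin-neg (lin-∘ {λ Q → T Q w} {c ◃_} (T-linear w) (lin-pre (c ∷ []))))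

T-cong : ∀ w {Q Q'} → Q ≋ Q' → T Q w ≋ T Q' w
T-cong w = lin-resp (T-linear w)

Tlin-linear : ∀ Q → Linear (Tlin Q)
Tlin-linear Q = ext-linear (T Q)

Tlin-word : ∀ Q w → Tlin Q ⟦ w ⟧ ≋ T Q w
Tlin-word Q w = ext-single (T Q) w

Tlin-letter : ∀ Q c X → Tlin Q (c ◃ X) ≋ (onX1 c (Q ⧢ X) ⊕ neg (Tlin (c ◃ Q) X))
Tlin-letter Q c = lin-agree {λ X → Tlin Q (c ◃ X)} {λ X → onX1 c (Q ⧢ X) ⊕ neg (Tlin (c ◃ Q) X)}
  (lin-∘ {Tlin Q} {c ◃_} (Tlin-linear Q) (lin-pre (c ∷ [])))
  (lin-plus {λ X → onX1 c (Q ⧢ X)} {λ X → neg (Tlin (c ◃ Q) X)} (lin-onX1 c {λ X → Q ⧢ X} (lin-⧢ʳ Q))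
     (lin-∘ {neg} {Tlin (c ◃ Q)} lin-neg (Tlin-linear (c ◃ Q))))
  (λ w → ≋-trans (Tlin-word Q (c ∷ w))
           (⊕-cong (≋-refl {onX1 c (Q ⧢ ⟦ w ⟧)}) (neg-cong (≋-sym (Tlin-word (c ◃ Q) w)))))

-- For words it is proved by induction on |u| + |w|, expanding both sides
-- by the letter recursions of ⧢ and T; the two auxiliary lemmas below
-- expand the shuffles that appear.

aP⧢shw-expand : ∀ a c P u v →
  ((a ◃ P) ⧢ shw (c ∷ u) v) ≋ (((a ◃ (P ⧢ ⟦ c ∷ u ⟧)) ⧢ ⟦ v ⟧) ⊕ ((c ◃ ((a ◃ P) ⧢ ⟦ u ⟧)) ⧢ ⟦ v ⟧))
aP⧢shw-expand a c P u v = begin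
    aP ⧢ shw (c ∷ u) v ≈⟨ ⧢-congʳ aP (≋-sym (⧢-words (c ∷ u) v)) ⟩
    aP ⧢ (⟦ c ∷ u ⟧ ⧢ ⟦ v ⟧) ≈⟨ ≋-sym (⧢-assoc aP ⟦ c ∷ u ⟧ ⟦ v ⟧) ⟩
    (aP ⧢ ⟦ c ∷ u ⟧) ⧢ ⟦ v ⟧ ≈⟨ ⧢-congˡ ⟦ v ⟧ (⧢-letters a c P ⟦ u ⟧) ⟩
    (a ◃ (P ⧢ ⟦ c ∷ u ⟧) ⊕ c ◃ (aP ⧢ ⟦ u ⟧)) ⧢ ⟦ v ⟧
      ≈⟨ lin-⊕ (lin-⧢ˡ ⟦ v ⟧) (a ◃ (P ⧢ ⟦ c ∷ u ⟧)) (c ◃ (aP ⧢ ⟦ u ⟧)) ⟩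
    ((a ◃ (P ⧢ ⟦ c ∷ u ⟧)) ⧢ ⟦ v ⟧) ⊕ ((c ◃ (aP ⧢ ⟦ u ⟧)) ⧢ ⟦ v ⟧) ∎
  where
  open PolyReasoning
  aP = a ◃ P

T-c-aP⧢-expand : ∀ c a d P w u →
  T (c ◃ ((a ◃ P) ⧢ ⟦ d ∷ w ⟧)) u ≋ (T (c ◃ (a ◃ (P ⧢ ⟦ d ∷ w ⟧))) u ⊕ T (c ◃ (d ◃ ((a ◃ P) ⧢ ⟦ w ⟧))) u)
T-c-aP⧢-expand c a d P w u =
  ≋-trans (T-cong u (≋-trans (pre-cong (c ∷ []) (⧢-letters a d P ⟦ w ⟧))
                             (pre-⊕ (c ∷ []) (a ◃ (P ⧢ ⟦ d ∷ w ⟧)) (d ◃ ((a ◃ P) ⧢ ⟦ w ⟧)))))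
    (lin-⊕ (T-linear u) (c ◃ (a ◃ (P ⧢ ⟦ d ∷ w ⟧))) (c ◃ (d ◃ ((a ◃ P) ⧢ ⟦ w ⟧))))

T-shuffle-cancel : ∀ F₁ E₂ X₁ X₂ E₁ X₃ F₂ X₄ →
  (((F₁ ⊕ E₂) ⊕ neg ((X₁ ⊕ X₂) ⊕ (E₁ ⊕ neg X₃))) ⊕ ((F₂ ⊕ E₁) ⊕ neg ((E₂ ⊕ neg X₂) ⊕ (X₄ ⊕ X₃))))
  ≋ ((F₁ ⊕ neg X₁) ⊕ (F₂ ⊕ neg X₄))
T-shuffle-cancel F₁ E₂ X₁ X₂ E₁ X₃ F₂ X₄ =
  by-coefficients
    (((atom F₁ ⊕e atom E₂) ⊕e nege ((atom X₁ ⊕e atom X₂) ⊕e (atom E₁ ⊕e nege (atom X₃))))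
      ⊕e ((atom F₂ ⊕e atom E₁) ⊕e nege ((atom E₂ ⊕e nege (atom X₂)) ⊕e (atom X₄ ⊕e atom X₃))))
    ((atom F₁ ⊕e nege (atom X₁)) ⊕e (atom F₂ ⊕e nege (atom X₄)))
    (λ w → solve 8 (λ f₁ e₂ x₁ x₂ e₁ x₃ f₂ x₄ →
       ((f₁ :+ e₂) :+ :- ((x₁ :+ x₂) :+ (e₁ :+ :- x₃))) :+ ((f₂ :+ e₁) :+ :- ((e₂ :+ :- x₂) :+ (x₄ :+ x₃)))
       := (f₁ :+ :- x₁) :+ (f₂ :+ :- x₄)) refl
       (coeff w F₁) (coeff w E₂) (coeff w X₁) (coeff w X₂) (coeff w E₁) (coeff w X₃) (coeff w F₂) (coeff w X₄))

T-shuffle-step : ∀ c d u w a P →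
  Tlin (c ◃ (a ◃ P)) (shw u (d ∷ w)) ≋ (T (c ◃ ((a ◃ P) ⧢ ⟦ d ∷ w ⟧)) u ⊕ T (c ◃ ((a ◃ P) ⧢ ⟦ u ⟧)) (d ∷ w)) →
  Tlin (d ◃ (a ◃ P)) (shw (c ∷ u) w) ≋ (T (d ◃ ((a ◃ P) ⧢ ⟦ w ⟧)) (c ∷ u) ⊕ T (d ◃ ((a ◃ P) ⧢ ⟦ c ∷ u ⟧)) w) →
  Tlin (a ◃ P) (shw (c ∷ u) (d ∷ w)) ≋ (T (a ◃ (P ⧢ ⟦ d ∷ w ⟧)) (c ∷ u) ⊕ T (a ◃ (P ⧢ ⟦ c ∷ u ⟧)) (d ∷ w))
T-shuffle-step c d u w a P ih₁ ih₂ = ≋-trans expand (T-shuffle-cancel F₁ E₂ X₁ X₂ E₁ X₃ F₂ X₄)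
  where
  open PolyReasoning
  aP = a ◃ P
  F₁ = onX1 c ((a ◃ (P ⧢ ⟦ d ∷ w ⟧)) ⧢ ⟦ u ⟧)
  F₂ = onX1 d ((a ◃ (P ⧢ ⟦ c ∷ u ⟧)) ⧢ ⟦ w ⟧)
  E₂ = onX1 c ((d ◃ (aP ⧢ ⟦ w ⟧)) ⧢ ⟦ u ⟧)
  E₁ = onX1 d ((c ◃ (aP ⧢ ⟦ u ⟧)) ⧢ ⟦ w ⟧)
  X₁ = T (c ◃ (a ◃ (P ⧢ ⟦ d ∷ w ⟧))) u
  X₂ = T (c ◃ (d ◃ (aP ⧢ ⟦ w ⟧))) u
  X₃ = T (d ◃ (c ◃ (aP ⧢ ⟦ u ⟧))) w
  X₄ = T (d ◃ (a ◃ (P ⧢ ⟦ c ∷ u ⟧))) w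
  shuffle₁ : onX1 c (aP ⧢ shw u (d ∷ w)) ≋ (F₁ ⊕ E₂)
  shuffle₁ = ≋-trans (onX1-cong c (≋-trans (⧢-congʳ aP (shw-comm u (d ∷ w))) (aP⧢shw-expand a d P w u)))
               (onX1-⊕ c _ _)
  shuffle₂ : onX1 d (aP ⧢ shw (c ∷ u) w) ≋ (F₂ ⊕ E₁)
  shuffle₂ = ≋-trans (onX1-cong d (aP⧢shw-expand a c P u w)) (onX1-⊕ d _ _)
  expand : Tlin aP (shw (c ∷ u) (d ∷ w)) ≋
    (((F₁ ⊕ E₂) ⊕ neg ((X₁ ⊕ X₂) ⊕ (E₁ ⊕ neg X₃))) ⊕ ((F₂ ⊕ E₁) ⊕ neg ((E₂ ⊕ neg X₂) ⊕ (X₄ ⊕ X₃))))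
  expand = begin
    Tlin aP ((c ◃ shw u (d ∷ w)) ⊕ (d ◃ shw (c ∷ u) w))
      ≈⟨ ext-⊕ (T aP) (c ◃ shw u (d ∷ w)) (d ◃ shw (c ∷ u) w) ⟩
    Tlin aP (c ◃ shw u (d ∷ w)) ⊕ Tlin aP (d ◃ shw (c ∷ u) w)
      ≈⟨ ⊕-cong (Tlin-letter aP c (shw u (d ∷ w))) (Tlin-letter aP d (shw (c ∷ u) w)) ⟩
    (onX1 c (aP ⧢ shw u (d ∷ w)) ⊕ neg (Tlin (c ◃ aP) (shw u (d ∷ w))))
      ⊕ (onX1 d (aP ⧢ shw (c ∷ u) w) ⊕ neg (Tlin (d ◃ aP) (shw (c ∷ u) w)))
      ≈⟨ ⊕-cong (⊕-cong shuffle₁ (neg-cong (≋-trans ih₁ (⊕-cong (T-c-aP⧢-expand c a d P w u) (≋-refl {E₁ ⊕ neg X₃})))))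
                (⊕-cong shuffle₂ (neg-cong (≋-trans ih₂ (⊕-cong (≋-refl {E₂ ⊕ neg X₂}) (T-c-aP⧢-expand d a c P u w))))) ⟩
    ((F₁ ⊕ E₂) ⊕ neg ((X₁ ⊕ X₂) ⊕ (E₁ ⊕ neg X₃))) ⊕ ((F₂ ⊕ E₁) ⊕ neg ((E₂ ⊕ neg X₂) ⊕ (X₄ ⊕ X₃))) ∎

T-shuffle-words : ∀ u w a P → Tlin (a ◃ P) (shw u w) ≋ (T (a ◃ (P ⧢ ⟦ w ⟧)) u ⊕ T (a ◃ (P ⧢ ⟦ u ⟧)) w)
T-shuffle-words [] w a P =
  ≋-trans (Tlin-word (a ◃ P) w) (T-cong w (pre-cong (a ∷ []) (≋-sym (⧢-identityʳ P))))
T-shuffle-words (c ∷ u) [] a P = ≋-trans (Tlin-word (a ◃ P) (c ∷ u))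
  (≋-trans (T-cong (c ∷ u) (pre-cong (a ∷ []) (≋-sym (⧢-identityʳ P))))
           (≋-sym (⊕-identityʳ (T (a ◃ (P ⧢ oneP)) (c ∷ u)))))
T-shuffle-words (c ∷ u) (d ∷ w) a P =
  T-shuffle-step c d u w a P (T-shuffle-words u (d ∷ w) c (a ◃ P)) (T-shuffle-words (c ∷ u) w d (a ◃ P))

T-leibniz : ∀ u a P W → Tlin (a ◃ P) (⟦ u ⟧ ⧢ W) ≋ (T (a ◃ (P ⧢ W)) u ⊕ Tlin (a ◃ (P ⧢ ⟦ u ⟧)) W)
T-leibniz u a P = lin-agree {λ W → Tlin (a ◃ P) (⟦ u ⟧ ⧢ W)} {λ W → T (a ◃ (P ⧢ W)) u ⊕ Tlin (a ◃ (P ⧢ ⟦ u ⟧)) W}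
  (lin-∘ {Tlin (a ◃ P)} {λ W → ⟦ u ⟧ ⧢ W} (Tlin-linear (a ◃ P)) (lin-⧢ʳ ⟦ u ⟧))
  (lin-plus {λ W → T (a ◃ (P ⧢ W)) u} {Tlin (a ◃ (P ⧢ ⟦ u ⟧))}
    (lin-∘ {λ X → T X u} {λ W → a ◃ (P ⧢ W)} (T-linear u) (lin-∘ {a ◃_} {λ W → P ⧢ W} (lin-pre (a ∷ [])) (lin-⧢ʳ P)))
    (Tlin-linear (a ◃ (P ⧢ ⟦ u ⟧))))
  (λ w → ≋-trans (ext-resp (T (a ◃ P)) (⧢-words u w))
     (≋-trans (T-shuffle-words u w a P)
              (⊕-cong (≋-refl {T (a ◃ (P ⧢ ⟦ w ⟧)) u}) (≋-sym (Tlin-word (a ◃ (P ⧢ ⟦ u ⟧)) w)))))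

neg1^-+ : ∀ m n → neg1^ (m ℕ.+ n) ≡ neg1^ m *ℚ neg1^ n
neg1^-+ zero n = sym (ℚP.*-identityˡ _)
neg1^-+ (suc m) n = trans (cong -_ (neg1^-+ m n))
  (solve 2 (λ a b → :- (a :* b) := (:- a) :* b) refl (neg1^ m) (neg1^ n))

neg1^-square : ∀ n → neg1^ n *ℚ neg1^ n ≡ 1ℚ
neg1^-square zero = refl
neg1^-square (suc n) = trans (solve 1 (λ a → (:- a) :* (:- a) := a :* a) refl (neg1^ n)) (neg1^-square n)

x0^-snoc : ∀ j → x0^ j ++ false ∷ [] ≡ false ∷ x0^ j
x0^-snoc zero = refl
x0^-snoc (suc j) = cong (false ∷_) (x0^-snoc j)

x0^-suc-++ : ∀ j X → x0^ (suc j) ++ X ≡ x0^ j ++ (false ∷ X)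
x0^-suc-++ j X = trans (cong (_++ X) (sym (x0^-snoc j))) (LP.++-assoc (x0^ j) (false ∷ []) X)

x0^-pre-x0 : ∀ j R → x0^ j · (false ◃ R) ≡ x0^ (suc j) · R
x0^-pre-x0 j R = trans (pre-pre (x0^ j) (false ∷ []) R) (cong (_· R) (x0^-snoc j))

T-x₀-prefix : ∀ j R V → T R (x0^ j ++ V) ≋ scale (neg1^ j) (T (x0^ j · R) V)
T-x₀-prefix zero R V = ≋-trans (T-cong V (≡⇒≋ (sym (pre-[] R)))) (≋-sym (scale-one (T ([] · R) V)))
T-x₀-prefix (suc j) R V = begin
    neg (T (false ◃ R) (x0^ j ++ V)) ≈⟨ neg-cong (T-x₀-prefix j (false ◃ R) V) ⟩
    neg (scale (neg1^ j) (T (x0^ j · (false ◃ R)) V)) ≈⟨ scale-scale (- 1ℚ) (neg1^ j) _ ⟩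
    scale (- 1ℚ *ℚ neg1^ j) (T (x0^ j · (false ◃ R)) V)
      ≈⟨ scale-≡ (T (x0^ j · (false ◃ R)) V) (solve 1 (λ x → con (- 1ℚ) :* x := :- x) refl (neg1^ j)) ⟩
    scale (neg1^ (suc j)) (T (x0^ j · (false ◃ R)) V)
      ≈⟨ scale-cong (neg1^ (suc j)) (T-cong V (≡⇒≋ (x0^-pre-x0 j R))) ⟩
    scale (neg1^ (suc j)) (T (x0^ (suc j) · R) V) ∎
  where open PolyReasoning

Tlin-x₀-prefix : ∀ j R X → Tlin R (x0^ j · X) ≋ scale (neg1^ j) (Tlin (x0^ j · R) X)
Tlin-x₀-prefix j R X = begin
    Tlin R (x0^ j · X) ≈⟨ Tlin-linear R (x0^ j · X) ⟩
    ext (λ w → Tlin R ⟦ w ⟧) (x0^ j · X) ≈⟨ ≡⇒≋ (ext-pre j X) ⟩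
    ext (λ w → Tlin R ⟦ x0^ j ++ w ⟧) X
      ≈⟨ ext-cong X (λ w → ≋-trans (Tlin-word R (x0^ j ++ w)) (T-x₀-prefix j R w)) ⟩
    ext (λ w → scale (neg1^ j) (T (x0^ j · R) w)) X ≈⟨ ext-fun-scale (T (x0^ j · R)) (neg1^ j) X ⟩
    scale (neg1^ j) (Tlin (x0^ j · R) X) ∎
  where
  open PolyReasoning
  ext-pre : ∀ j X → ext (λ w → Tlin R ⟦ w ⟧) (x0^ j · X) ≡ ext (λ w → Tlin R ⟦ x0^ j ++ w ⟧) X
  ext-pre j [] = refl
  ext-pre j ((c , w) ∷ X) = cong (scale c (Tlin R ⟦ x0^ j ++ w ⟧) ++_) (ext-pre j X)

T-y : ∀ k R → T R (y (suc k)) ≋ scale (neg1^ k) (x0^ k · R)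
T-y k R = ≋-trans (T-x₀-prefix k R (true ∷ []))
  (scale-cong (neg1^ k) (≋-trans (⊕-identityʳ ((x0^ k · R) ⧢ oneP)) (⧢-identityʳ (x0^ k · R))))

picks : List ℕ → List (ℕ × List ℕ)
picks [] = []
picks (k ∷ ks) = (k , ks) ∷ map (λ t → (proj₁ t , k ∷ proj₂ t)) (picks ks)

pickTerm : Poly → ℕ × List ℕ → Poly
pickTerm Q t = scale (- neg1^ (proj₁ t)) (x0^ (proj₁ t) · (Q ⧢ shY (proj₂ t)))

pickTerm-head : ∀ k Q S → T (false ◃ (Q ⧢ S)) (y (suc k)) ≋ scale (- neg1^ (suc k)) (x0^ (suc k) · (Q ⧢ S))
pickTerm-head k Q S = ≋-trans (T-y k (false ◃ (Q ⧢ S)))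
  (≋-trans (scale-≡ (x0^ k · (false ◃ (Q ⧢ S))) (solve 1 (λ x → x := :- (:- x)) refl (neg1^ k)))
    (scale-cong (- neg1^ (suc k)) (≡⇒≋ (x0^-pre-x0 k (Q ⧢ S)))))

T-x₀-shuffleY : ∀ K → All (1 ≤_) K → ∀ Q → Tlin (false ◃ Q) (shY K) ≋ sumP (map (pickTerm Q) (picks K))
T-x₀-shuffleY [] _ Q = Tlin-word (false ◃ Q) []
T-x₀-shuffleY (suc k ∷ K) (s≤s z≤n All.∷ pos) Q = begin
    Tlin (false ◃ Q) (⟦ y (suc k) ⟧ ⧢ shY K) ≈⟨ T-leibniz (y (suc k)) false Q (shY K) ⟩
    T (false ◃ (Q ⧢ shY K)) (y (suc k)) ⊕ Tlin (false ◃ (Q ⧢ ⟦ y (suc k) ⟧)) (shY K)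
      ≈⟨ ⊕-cong (pickTerm-head k Q (shY K)) (T-x₀-shuffleY K pos (Q ⧢ ⟦ y (suc k) ⟧)) ⟩
    pickTerm Q (suc k , K) ⊕ sumP (map (pickTerm (Q ⧢ ⟦ y (suc k) ⟧)) (picks K))
      ≈⟨ ⊕-cong (≋-refl {pickTerm Q (suc k , K)}) (≋-trans (sumP-cong _ _ (picks K) reassoc)
                                                     (≡⇒≋ (cong sumP (LP.map-∘ (picks K))))) ⟩
    sumP (map (pickTerm Q) (picks (suc k ∷ K))) ∎
  where
  open PolyReasoning
  reassoc : ∀ t → pickTerm (Q ⧢ ⟦ y (suc k) ⟧) t ≋ pickTerm Q (proj₁ t , suc k ∷ proj₂ t)
  reassoc t = scale-cong (- neg1^ (proj₁ t)) (pre-cong (x0^ (proj₁ t)) (⧢-assoc Q ⟦ y (suc k) ⟧ (shY (proj₂ t))))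

shY-snoc : ∀ ks n → (⟦ y n ⟧ ⧢ shY ks) ≋ shY (ks ∷ʳ n)
shY-snoc [] n = ≋-refl
shY-snoc (k ∷ ks) n = begin
    ⟦ y n ⟧ ⧢ (⟦ y k ⟧ ⧢ shY ks) ≈⟨ ≋-sym (⧢-assoc ⟦ y n ⟧ ⟦ y k ⟧ (shY ks)) ⟩
    (⟦ y n ⟧ ⧢ ⟦ y k ⟧) ⧢ shY ks ≈⟨ ⧢-congˡ (shY ks) (⧢-comm ⟦ y n ⟧ ⟦ y k ⟧) ⟩
    (⟦ y k ⟧ ⧢ ⟦ y n ⟧) ⧢ shY ks ≈⟨ ⧢-assoc ⟦ y k ⟧ ⟦ y n ⟧ (shY ks) ⟩
    ⟦ y k ⟧ ⧢ (⟦ y n ⟧ ⧢ shY ks) ≈⟨ ⧢-congʳ ⟦ y k ⟧ (shY-snoc ks n) ⟩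
    ⟦ y k ⟧ ⧢ shY (ks ∷ʳ n) ∎
  where open PolyReasoning

-- Generalising φ(y_{k₁}⋯y_{k_m}) by an accumulator R that
-- is appended to every reversed prefix, the sum defining φ telescopes:
-- its a = 0 term is the word itself, and the remaining terms are, up to the
-- sign (-1)^{k₁}, the same sum for k₂⋯k_m with accumulator k₁ ∷ R.

φTerm : List ℕ → List ℕ → ℕ → Poly
φTerm R ks a = scale (neg1^ (sumℕ (take a ks))) (⟦ yword (reverse (take a ks) ++ R) ⟧ ⧢ ⟦ yword (drop a ks) ⟧)

φAcc : List ℕ → List ℕ → Poly
φAcc R ks = sumP (map (φTerm R ks) (upTo (suc (length ks))))

map-upTo-suc : ∀ {A : Set} (f : ℕ → A) m → map f (upTo (suc m)) ≡ f 0 ∷ map (λ i → f (suc i)) (upTo m)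
map-upTo-suc f m = trans (LP.map-applyUpTo (λ i → i) f (suc m))
  (cong (f 0 ∷_) (sym (LP.map-applyUpTo (λ i → i) (λ i → f (suc i)) m)))

φTerm-suc : ∀ R k ks a → φTerm R (k ∷ ks) (suc a) ≋ scale (neg1^ k) (φTerm (k ∷ R) ks a)
φTerm-suc R k ks a = ≋-trans (scale-≡ _ (neg1^-+ k (sumℕ (take a ks))))
  (≋-trans (≋-sym (scale-scale (neg1^ k) (neg1^ (sumℕ (take a ks))) _))
    (scale-cong (neg1^ k) (scale-cong (neg1^ (sumℕ (take a ks)))
      (≡⇒≋ (cong (λ X → ⟦ yword X ⟧ ⧢ ⟦ yword (drop a ks) ⟧) reverse-cons)))))
  where
  reverse-cons : reverse (k ∷ take a ks) ++ R ≡ reverse (take a ks) ++ (k ∷ R)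
  reverse-cons = trans (cong (_++ R) (LP.unfold-reverse k (take a ks))) (LP.++-assoc (reverse (take a ks)) (k ∷ []) R)

T-yword-cons : ∀ k ks R → T ⟦ true ∷ yword R ⟧ (yword (suc k ∷ ks)) ≋
  scale (neg1^ k) ((⟦ yword (suc k ∷ R) ⟧ ⧢ ⟦ yword ks ⟧) ⊖ T ⟦ true ∷ yword (suc k ∷ R) ⟧ (yword ks))
T-yword-cons k ks R =
  ≋-trans (≡⇒≋ (cong (T ⟦ true ∷ yword R ⟧) (LP.++-assoc (x0^ k) (true ∷ []) (yword ks))))
    (≋-trans (T-x₀-prefix k ⟦ true ∷ yword R ⟧ (true ∷ yword ks))
      (scale-cong (neg1^ k) (≡⇒≋ (cong (λ X → T ⟦ X ⟧ (true ∷ yword ks))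
                                       (sym (LP.++-assoc (x0^ k) (true ∷ []) (yword R)))))))

φAcc-T : ∀ ks R → All (1 ≤_) ks →
  φAcc R ks ≋ ((⟦ yword R ⟧ ⧢ ⟦ yword ks ⟧) ⊖ T ⟦ true ∷ yword R ⟧ (yword ks))
φAcc-T [] R _ = ⊕-cong (scale-one (⟦ yword R ⟧ ⧢ ⟦ [] ⟧)) (≋-refl {[]})
φAcc-T (suc k ∷ ks) R (s≤s z≤n All.∷ pos) = begin
    φAcc R (suc k ∷ ks) ≈⟨ ≡⇒≋ (cong sumP (map-upTo-suc (φTerm R (suc k ∷ ks)) (suc (length ks)))) ⟩
    φTerm R (suc k ∷ ks) 0 ⊕ sumP (map (λ i → φTerm R (suc k ∷ ks) (suc i)) (upTo (suc (length ks))))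
      ≈⟨ ⊕-cong (scale-one A)
           (≋-trans (sumP-cong _ _ (upTo (suc (length ks))) (φTerm-suc R (suc k) ks))
             (sumP-scale (neg1^ (suc k)) (φTerm (suc k ∷ R) ks) (upTo (suc (length ks))))) ⟩
    A ⊕ scale (neg1^ (suc k)) (φAcc (suc k ∷ R) ks) ≈⟨ ⊕-cong (≋-refl {A}) (scale-cong (neg1^ (suc k)) (φAcc-T ks (suc k ∷ R) pos)) ⟩
    A ⊕ scale (neg1^ (suc k)) (B ⊖ C)
      ≈⟨ by-coefficients (atom A ⊕e scalee (neg1^ (suc k)) (atom B ⊕e nege (atom C)))
                         (atom A ⊕e nege (scalee (neg1^ k) (atom B ⊕e nege (atom C))))
           (λ w → solve 4 (λ a s b c → a :+ (:- s) :* (b :+ :- c) := a :+ :- (s :* (b :+ :- c))) refl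
              (coeff w A) (neg1^ k) (coeff w B) (coeff w C)) ⟩
    A ⊖ scale (neg1^ k) (B ⊖ C) ≈⟨ ⊕-cong (≋-refl {A}) (neg-cong (≋-sym (T-yword-cons k ks R))) ⟩
    A ⊖ T ⟦ true ∷ yword R ⟧ (yword (suc k ∷ ks)) ∎
  where
  open PolyReasoning
  A = ⟦ yword R ⟧ ⧢ ⟦ yword (suc k ∷ ks) ⟧
  B = ⟦ yword (suc k ∷ R) ⟧ ⧢ ⟦ yword ks ⟧
  C = T ⟦ true ∷ yword (suc k ∷ R) ⟧ (yword ks)

φY-T : ∀ ks → All (1 ≤_) ks → φY ks ≋ (⟦ yword ks ⟧ ⊖ T ⟦ true ∷ [] ⟧ (yword ks))
φY-T ks pos = ≋-trans (≡⇒≋ (cong sumP (LP.map-cong no-accumulator (upTo (suc (length ks))))))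
  (≋-trans (φAcc-T ks [] pos) (⊕-cong (⧢-identityˡ ⟦ yword ks ⟧) (≋-refl {neg (T ⟦ true ∷ [] ⟧ (yword ks))})))
  where
  no-accumulator : ∀ a → scale (neg1^ (sumℕ (take a ks))) (⟦ yword (reverse (take a ks)) ⟧ ⧢ ⟦ yword (drop a ks) ⟧)
                           ≡ φTerm [] ks a
  no-accumulator a = cong (λ X → scale (neg1^ (sumℕ (take a ks))) (⟦ yword X ⟧ ⧢ ⟦ yword (drop a ks) ⟧))
                          (sym (LP.++-identityʳ (reverse (take a ks))))

EndsX1 : Word → Set
EndsX1 w = Σ Word (λ v → w ≡ v ++ true ∷ [])

parse-x1-ending : ∀ v n → Σ (List ℕ) (λ ks → All (1 ≤_) ks × parseAux n (v ++ true ∷ []) ≡ just ks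
                                               × yword ks ≡ x0^ n ++ (v ++ true ∷ []))
parse-x1-ending [] n = (suc n ∷ []) , (s≤s z≤n All.∷ All.[]) , refl , LP.++-identityʳ _
parse-x1-ending (false ∷ v) n with parse-x1-ending v (suc n)
... | ks , pos , parsed , spelled = ks , pos , parsed , trans spelled (x0^-suc-++ n (v ++ true ∷ []))
parse-x1-ending (true ∷ v) n with parseAux 0 (v ++ true ∷ []) | parse-x1-ending v 0
... | .(just ks) | ks , pos , refl , spelled = (suc n ∷ ks) , (s≤s z≤n All.∷ pos) , refl ,
  trans (cong (y (suc n) ++_) spelled) (LP.++-assoc (x0^ n) (true ∷ []) (v ++ true ∷ []))

φw-parse : ∀ w ks → parse w ≡ just ks → φw w ≡ φY ks
φw-parse w ks parsed rewrite parsed = refl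

φ-word-T : ∀ w → EndsX1 w → φw w ≋ (⟦ w ⟧ ⊖ T ⟦ true ∷ [] ⟧ w)
φ-word-T .(v ++ true ∷ []) (v , refl) with parse-x1-ending v 0
... | ks , pos , parsed , spelled = ≋-trans (≡⇒≋ (φw-parse (v ++ true ∷ []) ks parsed))
  (≋-trans (φY-T ks pos) (≡⇒≋ (cong (λ X → ⟦ X ⟧ ⊖ T ⟦ true ∷ [] ⟧ X) spelled)))

-- Every word of y_{k₁} ⧢ ⋯ ⧢ y_{k_m} (m ≥ 1) ends in x₁; for m = 0 the
-- only word is 1.  Hence these shuffles lie in 𝔥¹, where (1) applies.

InH1 : Word → Set
InH1 w = EndsX1 w ⊎ w ≡ []

AllW : (Word → Set) → Poly → Set
AllW Pr P = All (λ t → Pr (proj₂ t)) P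

EndsX1-[] : ¬ EndsX1 []
EndsX1-[] ([] , ())
EndsX1-[] (_ ∷ _ , ())

EndsX1-tail : ∀ a w → EndsX1 (a ∷ w) → InH1 w
EndsX1-tail a w ([] , refl) = inj₂ refl
EndsX1-tail a w (b ∷ v , refl) = inj₁ (v , refl)

InH1-nonempty : ∀ a w → InH1 (a ∷ w) → EndsX1 (a ∷ w)
InH1-nonempty a w (inj₁ e) = e
InH1-nonempty a w (inj₂ ())

EndsX1-++ : ∀ u w → EndsX1 w → EndsX1 (u ++ w)
EndsX1-++ u w (v , refl) = (u ++ v) , sym (LP.++-assoc u v (true ∷ []))

AllW-pre : ∀ {Pr : Word → Set} u P → AllW (λ w → Pr (u ++ w)) P → AllW Pr (u · P)
AllW-pre u [] All.[] = All.[]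
AllW-pre u ((c , w) ∷ P) (h All.∷ hs) = h All.∷ AllW-pre u P hs

AllW-scale : ∀ {Pr : Word → Set} c P → AllW Pr P → AllW Pr (scale c P)
AllW-scale c [] All.[] = All.[]
AllW-scale c ((d , w) ∷ P) (h All.∷ hs) = h All.∷ AllW-scale c P hs

shw-EndsX1 : ∀ u v → (EndsX1 u × InH1 v) ⊎ (InH1 u × EndsX1 v) → AllW EndsX1 (shw u v)
shw-EndsX1 [] v (inj₁ (e , _)) = ⊥-elim (EndsX1-[] e)
shw-EndsX1 [] v (inj₂ (_ , e)) = e All.∷ All.[]
shw-EndsX1 (a ∷ u) [] (inj₁ (e , _)) = e All.∷ All.[]
shw-EndsX1 (a ∷ u) [] (inj₂ (_ , e)) = ⊥-elim (EndsX1-[] e)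
shw-EndsX1 (a ∷ u) (b ∷ v) h = AllP.++⁺
    (AllW-pre (a ∷ []) (shw u (b ∷ v))
      (All.map (λ {t} → EndsX1-++ (a ∷ []) (proj₂ t)) (shw-EndsX1 u (b ∷ v) (inj₂ (EndsX1-tail a u eu , ev)))))
    (AllW-pre (b ∷ []) (shw (a ∷ u) v)
      (All.map (λ {t} → EndsX1-++ (b ∷ []) (proj₂ t)) (shw-EndsX1 (a ∷ u) v (inj₁ (eu , EndsX1-tail b v ev)))))
  where
  both : (EndsX1 (a ∷ u) × InH1 (b ∷ v)) ⊎ (InH1 (a ∷ u) × EndsX1 (b ∷ v)) → EndsX1 (a ∷ u) × EndsX1 (b ∷ v)
  both (inj₁ (e , g)) = e , InH1-nonempty b v g
  both (inj₂ (g , e)) = InH1-nonempty a u g , e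
  eu = proj₁ (both h)
  ev = proj₂ (both h)

⧢-single-EndsX1 : ∀ c u Q → EndsX1 u → AllW InH1 Q → AllW EndsX1 (((c , u) ∷ []) ⧢ Q)
⧢-single-EndsX1 c u [] eu All.[] = All.[]
⧢-single-EndsX1 c u ((d , v) ∷ Q) eu (g All.∷ gs) =
  AllP.++⁺ (AllP.++⁺ (AllW-scale (c *ℚ d) (shw u v) (shw-EndsX1 u v (inj₁ (eu , g))))
                     (AllP.++⁻ˡ _ (⧢-single-EndsX1 c u Q eu gs))) All.[]

shY-EndsX1 : ∀ k ks → AllW EndsX1 (shY (k ∷ ks))
shY-InH1 : ∀ ks → AllW InH1 (shY ks)
shY-EndsX1 k ks = ⧢-single-EndsX1 1ℚ (y k) (shY ks) (x0^ (k ∸ 1) , refl) (shY-InH1 ks)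
shY-InH1 [] = inj₂ refl All.∷ All.[]
shY-InH1 (k ∷ ks) = All.map inj₁ (shY-EndsX1 k ks)

φ-ext : ∀ P → φ P ≡ ext φw P
φ-ext [] = refl
φ-ext ((c , w) ∷ P) = cong (scale c (φw w) ++_) (φ-ext P)

φ-on-EndsX1 : ∀ X → AllW EndsX1 X → φ X ≋ (X ⊖ Tlin ⟦ true ∷ [] ⟧ X)
φ-on-EndsX1 X ends = begin
    φ X ≈⟨ ≡⇒≋ (φ-ext X) ⟩
    ext φw X ≈⟨ ext-cong-All X (All.map (λ {t} → φ-word-T (proj₂ t)) ends) ⟩
    ext (λ w → ⟦ w ⟧ ⊕ neg (T x₁ w)) X ≈⟨ ext-fun-⊕ ⟦_⟧ (λ w → neg (T x₁ w)) X ⟩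
    ext ⟦_⟧ X ⊕ ext (λ w → neg (T x₁ w)) X ≈⟨ ⊕-cong (ext-id X) (ext-fun-scale (T x₁) (- 1ℚ) X) ⟩
    X ⊖ Tlin x₁ X ∎
  where
  open PolyReasoning
  x₁ = ⟦ true ∷ [] ⟧

sign-cancel : ∀ n X Y → scale (neg1^ n) (X ⊖ scale (neg1^ n) Y) ≋ (scale (neg1^ n) X ⊖ Y)
sign-cancel n X Y = ≋-trans
  (by-coefficients (scalee s (atom X ⊕e nege (scalee s (atom Y)))) (scalee s (atom X) ⊕e nege (scalee (s *ℚ s) (atom Y)))
    (λ w → solve 3 (λ s x y → s :* (x :+ :- (s :* y)) := s :* x :+ :- ((s :* s) :* y)) refl s (coeff w X) (coeff w Y)))
  (⊕-cong (≋-refl {scale s X}) (neg-cong (≋-trans (scale-≡ Y (neg1^-square n)) (scale-one Y))))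
  where
  s = neg1^ n

signedTerm : ℕ × List ℕ → Poly
signedTerm t = scale (neg1^ (proj₁ t)) (x0^ (proj₁ t) · shY (proj₂ t))

appendRest : ℕ → ℕ × List ℕ → ℕ × List ℕ
appendRest n t = (proj₁ t , proj₂ t ∷ʳ n)

pickTerm-signed : ∀ n ks → All (1 ≤_) ks →
  neg (Tlin (false ◃ ⟦ y (suc n) ⟧) (shY ks)) ≋ sumP (map (λ t → signedTerm (appendRest (suc n) t)) (picks ks))
pickTerm-signed n ks pos =
  ≋-trans (neg-cong (T-x₀-shuffleY ks pos ⟦ y (suc n) ⟧))
    (≋-trans (neg-sumP (λ t → neg1^ (proj₁ t)) (λ t → x0^ (proj₁ t) · (⟦ y (suc n) ⟧ ⧢ shY (proj₂ t))) (picks ks))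
      (sumP-cong _ _ (picks ks) (λ t → scale-cong (neg1^ (proj₁ t)) (pre-cong (x0^ (proj₁ t)) (shY-snoc (proj₂ t) (suc n))))))

-- The theorem with the right-hand side grouped as (terms a < r) + (term a = r).
φ-signed-x₀-shY : ∀ n ks → 1 ≤ length ks → All (1 ≤_) ks →
  φ (scale (neg1^ (suc n)) (x0^ (suc n) · shY ks)) ≋
  (sumP (map (λ t → signedTerm (appendRest (suc n) t)) (picks ks)) ⊕ signedTerm (suc n , ks))
φ-signed-x₀-shY n (k ∷ ks) _ pos = begin
    φ (scale s X) ≈⟨ ≡⇒≋ (φ-ext (scale s X)) ⟩
    ext φw (scale s X) ≈⟨ ext-scale φw s X ⟩
    scale s (ext φw X) ≈⟨ scale-cong s (≡⇒≋ (sym (φ-ext X))) ⟩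
    scale s (φ X) ≈⟨ scale-cong s (φ-on-EndsX1 X ends) ⟩
    scale s (X ⊖ Tlin ⟦ true ∷ [] ⟧ X)
      ≈⟨ scale-cong s (⊕-cong (≋-refl {X}) (neg-cong (Tlin-x₀-prefix (suc n) ⟦ true ∷ [] ⟧ S))) ⟩
    scale s (X ⊖ scale s (Tlin (false ◃ ⟦ y (suc n) ⟧) S)) ≈⟨ sign-cancel (suc n) X _ ⟩
    scale s X ⊖ Tlin (false ◃ ⟦ y (suc n) ⟧) S ≈⟨ ⊕-cong (≋-refl {scale s X}) (pickTerm-signed n (k ∷ ks) pos) ⟩
    scale s X ⊕ sumP (map (λ t → signedTerm (appendRest (suc n) t)) (picks (k ∷ ks))) ≈⟨ ⊕-comm (scale s X) _ ⟩
    sumP (map (λ t → signedTerm (appendRest (suc n) t)) (picks (k ∷ ks))) ⊕ signedTerm (suc n , k ∷ ks) ∎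
  where
  open PolyReasoning
  s = neg1^ (suc n)
  S = shY (k ∷ ks)
  X = x0^ (suc n) · S
  ends : AllW EndsX1 X
  ends = AllW-pre (x0^ (suc n)) S (All.map (λ {t} → EndsX1-++ (x0^ (suc n)) (proj₂ t)) (shY-EndsX1 k ks))

-- Reindexing: summing over the positions of ks ∷ʳ n is summing over the
-- picks from ks (with n appended to the rest) and then the last position.

picks-positions : ∀ {B : Set} (g : ℕ × List ℕ → B) xs →
  tabulate (λ a → g (lookup xs a , removeAt xs a)) ≡ map g (picks xs)
picks-positions g [] = refl
picks-positions g (k ∷ xs) = cong (g (k , xs) ∷_)
  (trans (picks-positions (λ t → g (proj₁ t , k ∷ proj₂ t)) xs) (LP.map-∘ (picks xs)))

picks-snoc : ∀ xs n → picks (xs ∷ʳ n) ≡ map (appendRest n) (picks xs) ∷ʳ (n , xs)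
picks-snoc [] n = refl
picks-snoc (k ∷ xs) n = cong ((k , xs ∷ʳ n) ∷_) (begin
    map consK (picks (xs ∷ʳ n)) ≡⟨ cong (map consK) (picks-snoc xs n) ⟩
    map consK (map (appendRest n) (picks xs) ∷ʳ (n , xs)) ≡⟨ LP.map-++ consK (map (appendRest n) (picks xs)) ((n , xs) ∷ []) ⟩
    map consK (map (appendRest n) (picks xs)) ∷ʳ (n , k ∷ xs) ≡⟨ cong (_∷ʳ (n , k ∷ xs)) (sym (LP.map-∘ (picks xs))) ⟩
    map (λ t → consK (appendRest n t)) (picks xs) ∷ʳ (n , k ∷ xs) ≡⟨ cong (_∷ʳ (n , k ∷ xs)) (LP.map-∘ (picks xs)) ⟩
    map (appendRest n) (map consK (picks xs)) ∷ʳ (n , k ∷ xs) ∎)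
  where
  open ≡-Reasoning
  consK : ℕ × List ℕ → ℕ × List ℕ
  consK t = (proj₁ t , k ∷ proj₂ t)

sum-positions-snoc : ∀ (g : ℕ × List ℕ → Poly) ks n →
  sumP (map (λ a → g (lookup (ks ∷ʳ n) a , removeAt (ks ∷ʳ n) a)) (allFin (length (ks ∷ʳ n))))
    ≋ (sumP (map (λ t → g (appendRest n t)) (picks ks)) ⊕ g (n , ks))
sum-positions-snoc g ks n = begin
    sumP (map (λ a → g (lookup xs a , removeAt xs a)) (allFin (length xs)))
      ≈⟨ ≡⇒≋ (cong sumP (trans (LP.map-tabulate (λ i → i) _) (picks-positions g xs))) ⟩
    sumP (map g (picks xs)) ≈⟨ ≡⇒≋ (cong (λ L → sumP (map g L)) (picks-snoc ks n)) ⟩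
    sumP (map g (map (appendRest n) (picks ks) ∷ʳ (n , ks)))
      ≈⟨ ≡⇒≋ (cong sumP (trans (LP.map-++ g (map (appendRest n) (picks ks)) ((n , ks) ∷ []))
                               (cong (_∷ʳ g (n , ks)) (sym (LP.map-∘ (picks ks)))))) ⟩
    sumP (map (λ t → g (appendRest n t)) (picks ks) ∷ʳ g (n , ks))
      ≈⟨ sumP-++ (map (λ t → g (appendRest n t)) (picks ks)) (g (n , ks) ∷ []) ⟩
    sumP (map (λ t → g (appendRest n t)) (picks ks)) ⊕ (g (n , ks) ⊕ zeroP)
      ≈⟨ ⊕-cong (≋-refl {sumP (map (λ t → g (appendRest n t)) (picks ks))}) (⊕-identityʳ (g (n , ks))) ⟩
    sumP (map (λ t → g (appendRest n t)) (picks ks)) ⊕ g (n , ks) ∎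
  where
  open PolyReasoning
  xs = ks ∷ʳ n

theorem4p6 : (ks : List ℕ) (kr : ℕ) → 1 ≤ length ks → All (1 ≤_) (ks ∷ʳ kr) →
    φ (scale (neg1^ kr) (x0^ kr · shY ks))
      ≈ sumP (map (λ a → scale (neg1^ (lookup (ks ∷ʳ kr) a))
                               (x0^ (lookup (ks ∷ʳ kr) a) · shY (removeAt (ks ∷ʳ kr) a)))
                  (allFin (length (ks ∷ʳ kr))))
theorem4p6 ks kr nonempty positive with AllP.++⁻ ks positive
... | ks-positive , (s≤s z≤n All.∷ All.[]) =
  ≋o (≋-trans (φ-signed-x₀-shY (kr ∸ 1) ks nonempty ks-positive)
              (≋-sym (sum-positions-snoc signedTerm ks kr)))
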